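{- For integer partitions $\lambda = (\lambda_1,\dots,\lambda_k)$ and $\mu$ of the same integer, $$[\widetilde{m}_{\mu}]\, r_{\lambda} = \frac{\prod_i \lambda_i!}{\prod_i \mu_i!} \sum_{(\mu^1,\dots,\mu^k)} \frac{1}{\prod_{i,j} n_i(\mu^j)!},$$ where the sum is over all puzzles $(\mu^1,\dots,\mu^k)$ of $\mu$ into $\lambda$, and consequently $$[m_\mu]\, r_\lambda = \frac{\prod_i \lambda_i!}{\prod_i \mu_i!}\,[m_\mu]\, p_\lambda .$$
   Context: For an integer partition $\lambda$, $n_i(\lambda)$ is the number of parts equal to $i$; $m_\lambda$, $p_\lambda$ are the monomial and power-sum symmetric functions; $\widetilde m_\lambda = (\prod_i n_i(\lambda)!) m_\lambda$. For a graph $H$, $X_H = \sum_\kappa \prod_v x_{\kappa(v)}$ over proper colorings $\kappa:V(H)\to\mathbb{N}$; $G_\lambda$ is the complete multipartite graph with stable sets of sizes $\lambda_1,\dots,\lambda_k$ and all edges between different stable sets; $r_\lambda = X_{G_\lambda}$. A puzzle of $\mu$ into $\lambda=(\lambda_1,\dots,\lambda_k)$ is an ordered tuple of integer partitions $(\mu^1,\dots,\mu^k)$ with $\mu^i \vdash \lambda_i$ for each $i$ and such that the multiset union of the parts of the $\mu^i$ equals the multiset of parts of $\mu$. $[f_\mu]g$ denotes the coefficient of $f_\mu$ in the expansion of $g$ in the basis $\{f_\nu\}$. -}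

module Defs where

open import Data.Nat using (ℕ; zero; suc; _+_; _*_; _≤_; _<_; _!; _≡ᵇ_; NonZero)
open import Data.Nat.Properties using (_!≢0; m*n≢0)
open import Data.Bool using (Bool; true; false; not; _∧_; if_then_else_)
open import Data.Fin using (Fin; toℕ)
open import Data.List using (List; []; _∷_; _++_; map; length; lookup; replicate; concatMap; filterᵇ; allFin; upTo; foldr; concat)
open import Data.Nat.ListAction using (sum; product)
open import Data.Bool.ListAction using (all)
open import Data.List.Relation.Unary.All using (All)
open import Data.List.Relation.Unary.Linked using (Linked)
open import Data.List.Relation.Binary.Pointwise using (Pointwise)
open import Data.List.Relation.Binary.Permutation.Propositional using (_↭_)
open import Data.Product using (_×_)
open import Data.Integer using (+_)
open import Data.Rational using (ℚ; _/_; 0ℚ) renaming (_+_ to _+ℚ_)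
open import Relation.Binary.PropositionalEquality using (_≡_)

IsPartition : List ℕ → Set
IsPartition ν = Linked (λ a b → b ≤ a) ν × All (λ a → 0 < a) ν

mult : ℕ → List ℕ → ℕ
mult i ν = length (filterᵇ (λ a → a ≡ᵇ i) ν)

prodFact : List ℕ → ℕ
prodFact []      = 1
prodFact (a ∷ ν) = a ! * prodFact ν

prodFact-nz : ∀ ν → NonZero (prodFact ν)
prodFact-nz []      = _
prodFact-nz (a ∷ ν) = m*n≢0 (a !) (prodFact ν) {{a !≢0}} {{prodFact-nz ν}}

-- ∏_i n_i(ν)!  (i ranges over 1 .. |ν|; every part of a partition ν
-- lies in this range)
multFact : List ℕ → ℕ
multFact ν = prodFact (map (λ i → mult (suc i) ν) (upTo (sum ν)))

multFact-nz : ∀ ν → NonZero (multFact ν)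
multFact-nz ν = prodFact-nz (map (λ i → mult (suc i) ν) (upTo (sum ν)))

multFactTuple : List (List ℕ) → ℕ
multFactTuple ps = product (map multFact ps)

multFactTuple-nz : ∀ ps → NonZero (multFactTuple ps)
multFactTuple-nz []       = _
multFactTuple-nz (p ∷ ps) =
  m*n≢0 (multFact p) (multFactTuple ps) {{multFact-nz p}} {{multFactTuple-nz ps}}

ℕtoℚ : ℕ → ℚ
ℕtoℚ n = (+ n) / 1

sumℚ : List ℚ → ℚ
sumℚ = foldr _+ℚ_ 0ℚ

factRatio : List ℕ → List ℕ → ℚ
factRatio lam mu = ((+ prodFact lam) / prodFact mu) {{prodFact-nz mu}}

puzzleWeight : List (List ℕ) → ℚ
puzzleWeight ps = ((+ 1) / multFactTuple ps) {{multFactTuple-nz ps}}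

record Graph : Set where
  field
    N   : ℕ
    adj : Fin N → Fin N → Bool
open Graph public

-- Complete multipartite graph G_λ: vertex v carries the label of its
-- stable set; blockLabels (λ_1,…,λ_k) = 0^{λ_1} 1^{λ_2} … (k-1)^{λ_k}.
blockLabelsFrom : ℕ → List ℕ → List ℕ
blockLabelsFrom i []        = []
blockLabelsFrom i (l ∷ lam) = replicate l i ++ blockLabelsFrom (suc i) lam

blockLabels : List ℕ → List ℕ
blockLabels = blockLabelsFrom 0

G : List ℕ → Graph
G lam = record
  { N   = length (blockLabels lam)
  ; adj = λ v w → not (lookup (blockLabels lam) v ≡ᵇ lookup (blockLabels lam) w)
  }

-- All functions Fin N → Fin ℓ, listed as lists of length N

allFuns : ℕ → ℕ → List (List ℕ)
allFuns zero    ℓ = [] ∷ []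
allFuns (suc N) ℓ = concatMap (λ c → map (c ∷_) (allFuns N ℓ)) (upTo ℓ)

at : List ℕ → ℕ → ℕ
at []      _       = 0
at (c ∷ κ) zero    = c
at (c ∷ κ) (suc v) = at κ v

-- Coefficient of m_μ in X_H: coefficient of the monomial
-- x_1^{μ_1} ⋯ x_ℓ^{μ_ℓ}, i.e. the number of proper colourings
-- κ : V(H) → {1,…,ℓ} with |κ⁻¹(j)| = μ_j for every j.

isProper : (H : Graph) → List ℕ → Bool
isProper H κ =
  all (λ v → all (λ w → not (adj H v w) Data.Bool.∨ not (at κ (toℕ v) ≡ᵇ at κ (toℕ w)))
                 (allFin (N H)))
      (allFin (N H))

hasContent : ℕ → List ℕ → List ℕ → Bool
hasContent n mu κ =
  all (λ j → length (filterᵇ (λ v → at κ v ≡ᵇ j) (upTo n)) ≡ᵇ at mu j)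
      (upTo (length mu))

coeffMX : Graph → List ℕ → ℕ
coeffMX H mu =
  length (filterᵇ (λ κ → isProper H κ ∧ hasContent (N H) mu κ)
                  (allFuns (N H) (length mu)))

-- r_λ = X_{G_λ};  [m_μ] r_λ
coeffMr : List ℕ → List ℕ → ℕ
coeffMr lam mu = coeffMX (G lam) mu

-- [m̃_μ] f = [m_μ] f / ∏_i n_i(μ)!
coeffMtildeR : List ℕ → List ℕ → ℚ
coeffMtildeR lam mu = ((+ coeffMr lam mu) / multFact mu) {{multFact-nz mu}}

-- coeffMp lam mu = [m_μ] p_λ: coefficient of x_1^{μ_1}⋯x_ℓ^{μ_ℓ} in ∏_i (Σ_j x_j^{λ_i}),
-- i.e. number of f : {1..k} → {1..ℓ} with Σ_{i : f i = j} λ_i = μ_j.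

weightOK : List ℕ → List ℕ → List ℕ → Bool
weightOK lam mu f =
  all (λ j → sum (map (λ i → if at f i ≡ᵇ j then at lam i else 0) (upTo (length lam)))
               ≡ᵇ at mu j)
      (upTo (length mu))

coeffMp : List ℕ → List ℕ → ℕ
coeffMp lam mu = length (filterᵇ (weightOK lam mu) (allFuns (length lam) (length mu)))

IsPuzzle : List ℕ → List ℕ → List (List ℕ) → Set
IsPuzzle mu lam ps =
  Pointwise (λ ν l → IsPartition ν × sum ν ≡ l) ps lam × (concat ps ↭ mu)

{-# OPTIONS --safe #-}
module Submission where

-- In the complete multipartite graph G λ two vertices are adjacent exactly when
-- they lie in different blocks, so a proper colouring with content μ amounts to
-- sending each part μ_j to a block and choosing μ_j still unused vertices of that
-- block.  For a fixed assignment of parts to blocks (these assignments are what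
-- [m_μ] p_λ counts) the choices number ∏_i λ_i! / ∏_j μ_j!, which is the second
-- formula.  Grouping the assignments by the puzzle (μ^1,…,μ^k) they induce, the
-- permutations of equal parts of μ act transitively on each fibre with stabiliser
-- of order ∏_{i,j} n_i(μ^j)!, so a fibre has ∏_i n_i(μ)! / ∏_{i,j} n_i(μ^j)!
-- elements; dividing by ∏_i n_i(μ)! gives the first formula.

module Counting where

  open import Data.Nat using (ℕ; zero; suc; _+_; _*_; _∸_; _≤_; _<_; _≡ᵇ_; _≤ᵇ_; z≤n; s≤s; _!)
  open import Data.Nat.Properties
  open import Algebra.Properties.CommutativeSemigroup +-commutativeSemigroup using ()
    renaming (interchange to +-interchange; x∙yz≈y∙xz to +-left-comm)
  open import Data.Nat.Tactic.RingSolver using (solve-∀)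
  open import Data.Nat.Combinatorics using (_C_; nCk≡n!/k![n-k]!; k![n∸k]!∣n!; k>n⇒nCk≡0; nCk+nC[k+1]≡[n+1]C[k+1])
  open import Data.Nat.DivMod using (m/n*n≡m)
  open import Data.Bool using (Bool; true; false; not; _∧_; _∨_; if_then_else_; T)
  open import Data.Bool.Properties using (∧-zeroʳ; T-∧; T-≡)
  open import Data.Bool.ListAction using (all)
  open import Data.List
    using (List; []; _∷_; _++_; map; length; filterᵇ; concatMap; concat; upTo; applyUpTo; lookup; allFin; replicate)
  open import Data.List.Properties using (≡-dec; length-applyUpTo; map-applyUpTo)
  open import Data.Nat.ListAction using (sum)
  open import Data.List.Membership.Propositional using (_∈_)
  open import Data.List.Membership.Propositional.Properties using (∈-map⁻; ∈-concat⁻′; ∈-upTo⁻; ∈-++⁻; ∈-allFin)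
  open import Data.List.Relation.Unary.Any using (here; there)
  open import Data.List.Relation.Unary.All using (All; []; _∷_; tabulate) renaming (lookup to All-lookup; map to All-map)
  open import Data.List.Relation.Unary.All.Properties using (++⁺; concat⁻; all⁺; all⁻)
  open import Data.List.Relation.Unary.AllPairs using (_∷_)
  open import Data.List.Relation.Unary.Linked using (Linked; []; [-]; _∷_)
  open import Data.List.Relation.Unary.Linked.Properties using (Linked⇒AllPairs)
  open import Data.List.Relation.Unary.Unique.Propositional using (Unique)
  open import Data.List.Relation.Binary.Pointwise using (Pointwise; []; _∷_; Pointwise-length)
  open import Data.List.Relation.Binary.Permutation.Propositional as ↭ using (_↭_; ↭-refl; ↭-prep; ↭-trans)
  open import Data.List.Relation.Binary.Permutation.Propositional.Properties using (++⁺ˡ; shift)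
  open import Data.Fin using (Fin; toℕ) renaming (zero to fzero; suc to fsuc)
  open import Data.Empty using (⊥; ⊥-elim)
  open import Data.Unit using (tt)
  open import Data.Sum using (_⊎_; inj₁; inj₂)
  open import Data.Product using (Σ; _×_; _,_; proj₁; proj₂)
  open import Function using (_∘_; id; _⇔_; Equivalence)
  open import Relation.Binary.PropositionalEquality
  open import Relation.Nullary using (¬_; yes; no; does; Dec)
  open import Defs

  𝟙 : Bool → ℕ
  𝟙 true  = 1
  𝟙 false = 0

  ∑< : ℕ → (ℕ → ℕ) → ℕ
  ∑< zero    g = 0
  ∑< (suc n) g = g 0 + ∑< n (g ∘ suc)

  syntax ∑< n (λ i → e) = ∑[ i < n ] e

  ∏< : ℕ → (ℕ → ℕ) → ℕ
  ∏< zero    g = 1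
  ∏< (suc n) g = g 0 * ∏< n (g ∘ suc)

  syntax ∏< n (λ i → e) = ∏[ i < n ] e

  ∑<-cong : ∀ n {g h : ℕ → ℕ} → (∀ i → i < n → g i ≡ h i) → ∑< n g ≡ ∑< n h
  ∑<-cong zero    e = refl
  ∑<-cong (suc n) e = cong₂ _+_ (e 0 (s≤s z≤n)) (∑<-cong n (λ i p → e (suc i) (s≤s p)))

  ∏<-cong : ∀ n {g h : ℕ → ℕ} → (∀ i → i < n → g i ≡ h i) → ∏< n g ≡ ∏< n h
  ∏<-cong zero    e = refl
  ∏<-cong (suc n) e = cong₂ _*_ (e 0 (s≤s z≤n)) (∏<-cong n (λ i p → e (suc i) (s≤s p)))

  ∑<-+ : ∀ n (g h : ℕ → ℕ) → ∑[ i < n ] (g i + h i) ≡ ∑< n g + ∑< n h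
  ∑<-+ zero    g h = refl
  ∑<-+ (suc n) g h = trans (cong (g 0 + h 0 +_) (∑<-+ n (g ∘ suc) (h ∘ suc))) (+-interchange (g 0) (h 0) _ _)

  ∑<-*ʳ : ∀ n (g : ℕ → ℕ) a → ∑[ i < n ] (g i * a) ≡ ∑< n g * a
  ∑<-*ʳ zero    g a = refl
  ∑<-*ʳ (suc n) g a = trans (cong (g 0 * a +_) (∑<-*ʳ n (g ∘ suc) a)) (sym (*-distribʳ-+ a (g 0) _))

  ∑<-*ˡ : ∀ n a (g : ℕ → ℕ) → ∑[ i < n ] (a * g i) ≡ a * ∑< n g
  ∑<-*ˡ n a g = trans (∑<-cong n (λ i _ → *-comm a (g i))) (trans (∑<-*ʳ n g a) (*-comm _ a))

  ∑<-zero : ∀ n {g : ℕ → ℕ} → (∀ i → i < n → g i ≡ 0) → ∑< n g ≡ 0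
  ∑<-zero n e = trans (∑<-cong n e) (∑<-0 n)
    where
    ∑<-0 : ∀ n → ∑[ i < n ] 0 ≡ 0
    ∑<-0 zero    = refl
    ∑<-0 (suc n) = ∑<-0 n

  ∑<-single : ∀ n (g : ℕ → ℕ) {b} → b < n → (∀ i → i < n → i ≢ b → g i ≡ 0) → ∑< n g ≡ g b
  ∑<-single (suc n) g {zero}  _ e =
    trans (cong (g 0 +_) (∑<-zero n (λ i q → e (suc i) (s≤s q) (λ ())))) (+-identityʳ _)
  ∑<-single (suc n) g {suc b} (s≤s p) e rewrite e 0 (s≤s z≤n) (λ ()) =
    ∑<-single n (g ∘ suc) p (λ i q ne → e (suc i) (s≤s q) (ne ∘ suc-injective))

  ∏<-one : ∀ n {g : ℕ → ℕ} → (∀ i → i < n → g i ≡ 1) → ∏< n g ≡ 1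
  ∏<-one zero    e = refl
  ∏<-one (suc n) e rewrite e 0 (s≤s z≤n) = trans (+-identityʳ _) (∏<-one n (λ i p → e (suc i) (s≤s p)))

  ∏<-snoc : ∀ n (g : ℕ → ℕ) → ∏< (suc n) g ≡ ∏< n g * g n
  ∏<-snoc zero    g = trans (*-identityʳ (g 0)) (sym (+-identityʳ (g 0)))
  ∏<-snoc (suc n) g = trans (cong (g 0 *_) (∏<-snoc n (g ∘ suc))) (sym (*-assoc (g 0) _ _))

  ∏<-update : ∀ n (g h : ℕ → ℕ) {b} → b < n → (∀ i → i < n → i ≢ b → g i ≡ h i) →
    ∏< n g * h b ≡ ∏< n h * g b
  ∏<-update (suc n) g h {zero} _ e
    rewrite ∏<-cong n {g ∘ suc} {h ∘ suc} (λ i q → e (suc i) (s≤s q) (λ ())) = swap (g 0) (h 0) _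
    where
    swap : ∀ x y r → x * r * y ≡ y * r * x
    swap = solve-∀
  ∏<-update (suc n) g h {suc b} (s≤s p) e rewrite e 0 (s≤s z≤n) (λ ()) =
    trans (*-assoc (h 0) _ (h (suc b)))
      (trans (cong (h 0 *_) (∏<-update n (g ∘ suc) (h ∘ suc) p (λ i q ne → e (suc i) (s≤s q) (ne ∘ suc-injective))))
        (sym (*-assoc (h 0) _ (g (suc b)))))

  ∑∈ : {A : Set} → List A → (A → ℕ) → ℕ
  ∑∈ []       g = 0
  ∑∈ (x ∷ xs) g = g x + ∑∈ xs g

  syntax ∑∈ xs (λ x → e) = ∑[ x ← xs ] e

  ∑∈-++ : ∀ {A : Set} xs ys (g : A → ℕ) → ∑∈ (xs ++ ys) g ≡ ∑∈ xs g + ∑∈ ys g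
  ∑∈-++ []       ys g = refl
  ∑∈-++ (x ∷ xs) ys g = trans (cong (g x +_) (∑∈-++ xs ys g)) (sym (+-assoc (g x) _ _))

  ∑∈-map : ∀ {A B : Set} (f : A → B) xs (g : B → ℕ) → ∑∈ (map f xs) g ≡ ∑∈ xs (g ∘ f)
  ∑∈-map f []       g = refl
  ∑∈-map f (x ∷ xs) g = cong (g (f x) +_) (∑∈-map f xs g)

  ∑∈-cong : ∀ {A : Set} xs {g h : A → ℕ} → (∀ x → x ∈ xs → g x ≡ h x) → ∑∈ xs g ≡ ∑∈ xs h
  ∑∈-cong []       e = refl
  ∑∈-cong (x ∷ xs) e = cong₂ _+_ (e x (here refl)) (∑∈-cong xs (λ y p → e y (there p)))

  ∑∈-+ : ∀ {A : Set} xs (g h : A → ℕ) → ∑[ x ← xs ] (g x + h x) ≡ ∑∈ xs g + ∑∈ xs h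
  ∑∈-+ []       g h = refl
  ∑∈-+ (x ∷ xs) g h = trans (cong (g x + h x +_) (∑∈-+ xs g h)) (+-interchange (g x) (h x) _ _)

  ∑∈-zero : ∀ {A : Set} (xs : List A) → ∑[ x ← xs ] 0 ≡ 0
  ∑∈-zero []       = refl
  ∑∈-zero (x ∷ xs) = ∑∈-zero xs

  ∑∈-∑<-comm : ∀ {A : Set} xs n (g : A → ℕ → ℕ) → ∑[ x ← xs ] ∑< n (g x) ≡ ∑[ i < n ] ∑[ x ← xs ] g x i
  ∑∈-∑<-comm []       n g = sym (∑<-zero n (λ _ _ → refl))
  ∑∈-∑<-comm (x ∷ xs) n g = trans (cong (∑< n (g x) +_) (∑∈-∑<-comm xs n g)) (sym (∑<-+ n (g x) _))

  ∑∈-comm : ∀ {A B : Set} xs ys (g : A → B → ℕ) → ∑[ x ← xs ] ∑∈ ys (g x) ≡ ∑[ y ← ys ] ∑[ x ← xs ] g x y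
  ∑∈-comm []       ys g = sym (∑∈-zero ys)
  ∑∈-comm (x ∷ xs) ys g = trans (cong (∑∈ ys (g x) +_) (∑∈-comm xs ys g)) (sym (∑∈-+ ys (g x) _))

  ∑∈-applyUpTo : ∀ {A : Set} (f : ℕ → A) n (g : A → ℕ) → ∑∈ (applyUpTo f n) g ≡ ∑< n (g ∘ f)
  ∑∈-applyUpTo f zero    g = refl
  ∑∈-applyUpTo f (suc n) g = cong (g (f 0) +_) (∑∈-applyUpTo (f ∘ suc) n g)

  ∑∈-concatMap : ∀ {A B : Set} (f : A → List B) xs (g : B → ℕ) → ∑∈ (concatMap f xs) g ≡ ∑[ x ← xs ] ∑∈ (f x) g
  ∑∈-concatMap f []       g = refl
  ∑∈-concatMap f (x ∷ xs) g =
    trans (∑∈-++ (f x) (concatMap f xs) g) (cong (∑∈ (f x) g +_) (∑∈-concatMap f xs g))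

  sum-applyUpTo : ∀ (f : ℕ → ℕ) n → sum (applyUpTo f n) ≡ ∑< n f
  sum-applyUpTo f zero    = refl
  sum-applyUpTo f (suc n) = cong (f 0 +_) (sum-applyUpTo (f ∘ suc) n)

  countᵇ : {A : Set} → (A → Bool) → List A → ℕ
  countᵇ p xs = length (filterᵇ p xs)

  countᵇ-≡-∑ : ∀ {A : Set} (p : A → Bool) xs → countᵇ p xs ≡ ∑[ x ← xs ] 𝟙 (p x)
  countᵇ-≡-∑ p []       = refl
  countᵇ-≡-∑ p (x ∷ xs) with p x
  ... | true  = cong suc (countᵇ-≡-∑ p xs)
  ... | false = countᵇ-≡-∑ p xs

  countᵇ-cong : ∀ {A : Set} xs {p q : A → Bool} → (∀ x → x ∈ xs → p x ≡ q x) → countᵇ p xs ≡ countᵇ q xs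
  countᵇ-cong xs {p} {q} e =
    trans (countᵇ-≡-∑ p xs) (trans (∑∈-cong xs (λ x x∈ → cong 𝟙 (e x x∈))) (sym (countᵇ-≡-∑ q xs)))

  countᵇ-∧ : ∀ {A : Set} b (q : A → Bool) xs → countᵇ (λ x → b ∧ q x) xs ≡ 𝟙 b * countᵇ q xs
  countᵇ-∧ true  q xs       = sym (+-identityʳ _)
  countᵇ-∧ false q []       = refl
  countᵇ-∧ false q (x ∷ xs) = countᵇ-∧ false q xs

  countᵇ-allFuns-suc : ∀ (p : List ℕ → Bool) N k →
    countᵇ p (allFuns (suc N) k) ≡ ∑[ c < k ] countᵇ (λ f → p (c ∷ f)) (allFuns N k)
  countᵇ-allFuns-suc p N k = begin
    countᵇ p (allFuns (suc N) k)
      ≡⟨ countᵇ-≡-∑ p (allFuns (suc N) k) ⟩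
    ∑∈ (concatMap (λ c → map (c ∷_) (allFuns N k)) (upTo k)) (𝟙 ∘ p)
      ≡⟨ ∑∈-concatMap _ (upTo k) (𝟙 ∘ p) ⟩
    ∑[ c ← upTo k ] ∑∈ (map (c ∷_) (allFuns N k)) (𝟙 ∘ p)
      ≡⟨ ∑∈-applyUpTo _ k _ ⟩
    ∑[ c < k ] ∑∈ (map (c ∷_) (allFuns N k)) (𝟙 ∘ p)
      ≡⟨ ∑<-cong k (λ c _ → ∑∈-map (c ∷_) (allFuns N k) (𝟙 ∘ p)) ⟩
    ∑[ c < k ] ∑[ f ← allFuns N k ] 𝟙 (p (c ∷ f))
      ≡⟨ ∑<-cong k (λ c _ → sym (countᵇ-≡-∑ _ (allFuns N k))) ⟩
    ∑[ c < k ] countᵇ (λ f → p (c ∷ f)) (allFuns N k) ∎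
    where open ≡-Reasoning

  allFuns-shape : ∀ {N ℓ f} → f ∈ allFuns N ℓ → length f ≡ N × All (_< ℓ) f
  allFuns-shape {zero} (here refl) = refl , []
  allFuns-shape {suc N} {ℓ} p
    with xs , f∈xs , xs∈ ← ∈-concat⁻′ (map (λ c → map (c ∷_) (allFuns N ℓ)) (upTo ℓ)) p
    with c , c∈ , refl ← ∈-map⁻ (λ c → map (c ∷_) (allFuns N ℓ)) xs∈
    with g , g∈ , refl ← ∈-map⁻ (c ∷_) f∈xs
    with e , a ← allFuns-shape {N} g∈
    = cong suc e , ∈-upTo⁻ c∈ ∷ a

  T-⇔⇒≡ : ∀ {x y} → (T x → T y) → (T y → T x) → x ≡ y
  T-⇔⇒≡ {false} {false} f g = refl
  T-⇔⇒≡ {false} {true}  f g = ⊥-elim (g tt)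
  T-⇔⇒≡ {true}  {false} f g = ⊥-elim (f tt)
  T-⇔⇒≡ {true}  {true}  f g = refl

  T⇒≡true : ∀ {b} → T b → b ≡ true
  T⇒≡true = Equivalence.to T-≡

  ¬T⇒≡false : ∀ {b} → ¬ T b → b ≡ false
  ¬T⇒≡false {false} _ = refl
  ¬T⇒≡false {true}  h = ⊥-elim (h tt)

  T-∧-intro : ∀ {x y} → T x → T y → T (x ∧ y)
  T-∧-intro p q = Equivalence.from T-∧ (p , q)

  T-∧-left : ∀ {x y} → T (x ∧ y) → T x
  T-∧-left = proj₁ ∘ Equivalence.to T-∧

  T-∧-right : ∀ {x y} → T (x ∧ y) → T y
  T-∧-right {x} = proj₂ ∘ Equivalence.to (T-∧ {x})

  ≡ᵇ-refl : ∀ n → (n ≡ᵇ n) ≡ true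
  ≡ᵇ-refl zero    = refl
  ≡ᵇ-refl (suc n) = ≡ᵇ-refl n

  ≢⇒≡ᵇ-false : ∀ {m n} → m ≢ n → (m ≡ᵇ n) ≡ false
  ≢⇒≡ᵇ-false {m} {n} m≢n = ¬T⇒≡false (m≢n ∘ ≡ᵇ⇒≡ m n)

  if-true : ∀ {A : Set} {b} {x y : A} → T b → (if b then x else y) ≡ x
  if-true {b = true} _ = refl

  if-false : ∀ {A : Set} {b} {x y : A} → ¬ T b → (if b then x else y) ≡ y
  if-false {b = false} _ = refl
  if-false {b = true}  h = ⊥-elim (h tt)

  allBelow : ℕ → (ℕ → Bool) → Bool
  allBelow zero    p = true
  allBelow (suc n) p = p 0 ∧ allBelow n (p ∘ suc)

  allBelow-intro : ∀ n p → (∀ i → i < n → T (p i)) → T (allBelow n p)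
  allBelow-intro zero    p h = tt
  allBelow-intro (suc n) p h = T-∧-intro (h 0 (s≤s z≤n)) (allBelow-intro n (p ∘ suc) (λ i q → h (suc i) (s≤s q)))

  allBelow-elim : ∀ n p → T (allBelow n p) → ∀ i → i < n → T (p i)
  allBelow-elim (suc n) p t zero    _       = T-∧-left t
  allBelow-elim (suc n) p t (suc i) (s≤s q) = allBelow-elim n (p ∘ suc) (T-∧-right {p 0} t) i q

  allBelow-cong : ∀ n {p q : ℕ → Bool} → (∀ i → i < n → p i ≡ q i) → allBelow n p ≡ allBelow n q
  allBelow-cong zero    e = refl
  allBelow-cong (suc n) e = cong₂ _∧_ (e 0 (s≤s z≤n)) (allBelow-cong n (λ i q → e (suc i) (s≤s q)))

  all-upTo : ∀ n (p : ℕ → Bool) → all p (upTo n) ≡ allBelow n p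
  all-upTo n p = go id n
    where
    go : ∀ f n → all p (applyUpTo f n) ≡ allBelow n (p ∘ f)
    go f zero    = refl
    go f (suc n) = cong (p (f 0) ∧_) (go (f ∘ suc) n)

  allBelow-const-true : ∀ n → allBelow n (λ _ → true) ≡ true
  allBelow-const-true zero    = refl
  allBelow-const-true (suc n) = allBelow-const-true n

  allBelow-false : ∀ n (p : ℕ → Bool) {i} → i < n → p i ≡ false → allBelow n p ≡ false
  allBelow-false n p i<n pᵢ = ¬T⇒≡false (λ t → subst T pᵢ (allBelow-elim n p t _ i<n))

  T-all-intro : ∀ {A : Set} (p : A → Bool) xs → (∀ {x} → x ∈ xs → T (p x)) → T (all p xs)
  T-all-intro p xs h = all⁻ p (tabulate h)

  T-all-elim : ∀ {A : Set} (p : A → Bool) xs → T (all p xs) → ∀ {x} → x ∈ xs → T (p x)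
  T-all-elim p xs t = All-lookup (all⁺ p xs t)

  -- Assignments of the parts of μ to the blocks of λ

  withdraw : (ℕ → ℕ) → ℕ → ℕ → (ℕ → ℕ)
  withdraw c b m x = if x ≡ᵇ b then c x ∸ m else c x

  withdraw-same : ∀ c b m → withdraw c b m b ≡ c b ∸ m
  withdraw-same c b m rewrite ≡ᵇ-refl b = refl

  withdraw-other : ∀ c {b} m {x} → x ≢ b → withdraw c b m x ≡ c x
  withdraw-other c m x≢b = if-false (x≢b ∘ ≡ᵇ⇒≡ _ _)

  -- Ways to send the parts to blocks 0, …, k-1 filling each block b to exactly c b.
  fillings : ℕ → (ℕ → ℕ) → List ℕ → ℕ
  fillings k c []       = 𝟙 (allBelow k (λ j → 0 ≡ᵇ c j))
  fillings k c (m ∷ mu) = ∑[ b < k ] (𝟙 (m ≤ᵇ c b) * fillings k (withdraw c b m) mu)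

  load : List ℕ → List ℕ → ℕ → ℕ
  load mu f j = ∑[ i < length mu ] (if at f i ≡ᵇ j then at mu i else 0)

  fills : List ℕ → (ℕ → ℕ) → ℕ → List ℕ → Bool
  fills mu c k f = allBelow k (λ j → load mu f j ≡ᵇ c j)

  fills-∷ : ∀ m mu c k {b} f → b < k → fills (m ∷ mu) c k (b ∷ f) ≡ (m ≤ᵇ c b) ∧ fills mu (withdraw c b m) k f
  fills-∷ m mu c k {b} f b<k = T-⇔⇒≡ to from
    where
    addₘ : ℕ → ℕ
    addₘ j = if b ≡ᵇ j then m else 0
    addₘ-b : addₘ b ≡ m
    addₘ-b = if-true (≡⇒≡ᵇ b b refl)
    addₘ-other : ∀ {j} → j ≢ b → addₘ j ≡ 0
    addₘ-other j≢b = if-false (j≢b ∘ sym ∘ ≡ᵇ⇒≡ _ _)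
    to : T (fills (m ∷ mu) c k (b ∷ f)) → T ((m ≤ᵇ c b) ∧ fills mu (withdraw c b m) k f)
    to t = T-∧-intro (≤⇒≤ᵇ m≤cb) (allBelow-intro k _ (λ j j<k → ≡⇒≡ᵇ _ _ (rest j j<k)))
      where
      full : ∀ j → j < k → addₘ j + load mu f j ≡ c j
      full j j<k = ≡ᵇ⇒≡ _ _ (allBelow-elim k _ t j j<k)
      full-b : m + load mu f b ≡ c b
      full-b = trans (cong (_+ load mu f b) (sym addₘ-b)) (full b b<k)
      m≤cb : m ≤ c b
      m≤cb = subst (m ≤_) full-b (m≤m+n m _)
      rest : ∀ j → j < k → load mu f j ≡ withdraw c b m j
      rest j j<k with j ≟ b
      ... | yes refl = trans (sym (m+n∸m≡n m _)) (trans (cong (_∸ m) full-b) (sym (withdraw-same c b m)))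
      ... | no j≢b   = trans (cong (_+ load mu f j) (sym (addₘ-other j≢b)))
                             (trans (full j j<k) (sym (withdraw-other c m j≢b)))
    from : T ((m ≤ᵇ c b) ∧ fills mu (withdraw c b m) k f) → T (fills (m ∷ mu) c k (b ∷ f))
    from t = allBelow-intro k _ (λ j j<k → ≡⇒≡ᵇ _ _ (full j j<k))
      where
      m≤cb : m ≤ c b
      m≤cb = ≤ᵇ⇒≤ m (c b) (T-∧-left t)
      rest : ∀ j → j < k → load mu f j ≡ withdraw c b m j
      rest j j<k = ≡ᵇ⇒≡ _ _ (allBelow-elim k _ (T-∧-right {m ≤ᵇ c b} t) j j<k)
      full : ∀ j → j < k → addₘ j + load mu f j ≡ c j
      full j j<k with j ≟ b
      ... | yes refl = trans (cong₂ _+_ addₘ-b (trans (rest j j<k) (withdraw-same c j m))) (m+[n∸m]≡n m≤cb)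
      ... | no j≢b   = cong₂ _+_ (addₘ-other j≢b) (trans (rest j j<k) (withdraw-other c m j≢b))

  count-fills : ∀ mu c k → countᵇ (fills mu c k) (allFuns (length mu) k) ≡ fillings k c mu
  count-fills [] c k with allBelow k (λ j → 0 ≡ᵇ c j)
  ... | true  = refl
  ... | false = refl
  count-fills (m ∷ mu) c k = begin
    countᵇ (fills (m ∷ mu) c k) (allFuns (suc (length mu)) k)
      ≡⟨ countᵇ-allFuns-suc (fills (m ∷ mu) c k) (length mu) k ⟩
    ∑[ b < k ] countᵇ (λ f → fills (m ∷ mu) c k (b ∷ f)) (allFuns (length mu) k)
      ≡⟨ ∑<-cong k (λ b b<k → countᵇ-cong (allFuns (length mu) k) (λ f _ → fills-∷ m mu c k f b<k)) ⟩
    ∑[ b < k ] countᵇ (λ f → (m ≤ᵇ c b) ∧ fills mu (withdraw c b m) k f) (allFuns (length mu) k)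
      ≡⟨ ∑<-cong k (λ b _ → countᵇ-∧ (m ≤ᵇ c b) _ (allFuns (length mu) k)) ⟩
    ∑[ b < k ] (𝟙 (m ≤ᵇ c b) * countᵇ (fills mu (withdraw c b m) k) (allFuns (length mu) k))
      ≡⟨ ∑<-cong k (λ b _ → cong (𝟙 (m ≤ᵇ c b) *_) (count-fills mu (withdraw c b m) k)) ⟩
    fillings k c (m ∷ mu) ∎
    where open ≡-Reasoning

  weightOK≡fills : ∀ mu lam f → weightOK mu lam f ≡ fills mu (at lam) (length lam) f
  weightOK≡fills mu lam f = trans (all-upTo (length lam) _)
    (allBelow-cong (length lam) (λ j _ → cong (_≡ᵇ at lam j) (sum-map-upTo (length mu) _)))
    where
    sum-map-upTo : ∀ n (g : ℕ → ℕ) → sum (map g (upTo n)) ≡ ∑< n g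
    sum-map-upTo n g = trans (cong sum (map-applyUpTo id g n)) (sum-applyUpTo g n)

  coeffMp≡fillings : ∀ mu lam → coeffMp mu lam ≡ fillings (length lam) (at lam) mu
  coeffMp≡fillings mu lam =
    trans (countᵇ-cong (allFuns (length mu) (length lam)) (λ f _ → weightOK≡fills mu lam f))
          (count-fills mu (at lam) (length lam))

  -- Ways to choose, part by part, a block and that many of its still unused vertices.
  blockSubsets : ℕ → (ℕ → ℕ) → List ℕ → ℕ
  blockSubsets k c []       = 𝟙 (allBelow k (λ j → 0 ≡ᵇ c j))
  blockSubsets k c (m ∷ mu) = ∑[ b < k ] ((c b C m) * blockSubsets k (withdraw c b m) mu)

  capacityFact : ℕ → (ℕ → ℕ) → ℕ
  capacityFact k c = ∏[ b < k ] (c b !)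

  capacityFact-empty : ∀ k c → T (allBelow k (λ j → 0 ≡ᵇ c j)) → capacityFact k c ≡ 1
  capacityFact-empty k c t = ∏<-one k (λ i i<k → cong _! (sym (≡ᵇ⇒≡ 0 (c i) (allBelow-elim k _ t i i<k))))

  nCk*k!*[n∸k]!≡n! : ∀ {n k} → k ≤ n → (n C k) * (k ! * (n ∸ k) !) ≡ n !
  nCk*k!*[n∸k]!≡n! {n} {k} k≤n =
    trans (cong (_* (k ! * (n ∸ k) !)) (nCk≡n!/k![n-k]! k≤n)) (m/n*n≡m {{_}} (k![n∸k]!∣n! k≤n))

  choose-withdraw : ∀ k c {b} m → b < k → m ≤ c b →
    (c b C m) * m ! * capacityFact k (withdraw c b m) ≡ capacityFact k c
  choose-withdraw k c {b} m b<k m≤cb = *-cancelʳ-≡ _ _ ((c b ∸ m) !) {{(c b ∸ m) !≢0}} (begin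
    (c b C m) * m ! * Πʷ * (c b ∸ m) !    ≡⟨ rearrange (c b C m) (m !) Πʷ ((c b ∸ m) !) ⟩
    Πʷ * ((c b C m) * (m ! * (c b ∸ m) !)) ≡⟨ cong (Πʷ *_) (nCk*k!*[n∸k]!≡n! m≤cb) ⟩
    Πʷ * c b !                            ≡⟨ ∏<-update k (λ x → withdraw c b m x !) (λ x → c x !) b<k
                                               (λ i _ i≢b → cong _! (withdraw-other c m i≢b)) ⟩
    capacityFact k c * withdraw c b m b !  ≡⟨ cong (λ z → capacityFact k c * z !) (withdraw-same c b m) ⟩
    capacityFact k c * (c b ∸ m) !         ∎)
    where
    open ≡-Reasoning
    Πʷ = capacityFact k (withdraw c b m)
    rearrange : ∀ x y p z → x * y * p * z ≡ p * (x * (y * z))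
    rearrange = solve-∀

  blockSubsets-*-prodFact : ∀ k c mu → blockSubsets k c mu * prodFact mu ≡ fillings k c mu * capacityFact k c
  blockSubsets-*-prodFact k c [] with allBelow k (λ j → 0 ≡ᵇ c j) in eq
  ... | true  = sym (trans (+-identityʳ _) (capacityFact-empty k c (subst T (sym eq) tt)))
  ... | false = refl
  blockSubsets-*-prodFact k c (m ∷ mu) =
    trans (sym (∑<-*ʳ k _ (m ! * prodFact mu))) (trans (∑<-cong k perBlock) (∑<-*ʳ k _ (capacityFact k c)))
    where
    perBlock : ∀ b → b < k →
      (c b C m) * blockSubsets k (withdraw c b m) mu * (m ! * prodFact mu)
        ≡ 𝟙 (m ≤ᵇ c b) * fillings k (withdraw c b m) mu * capacityFact k c
    perBlock b b<k with m ≤? c b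
    ... | no m≰cb rewrite k>n⇒nCk≡0 (≰⇒> m≰cb) | ¬T⇒≡false (m≰cb ∘ ≤ᵇ⇒≤ m (c b)) = refl
    ... | yes m≤cb = begin
      cCm * S * (m ! * prodFact mu)                 ≡⟨ rearrange cCm S (m !) (prodFact mu) ⟩
      cCm * m ! * (S * prodFact mu)                 ≡⟨ cong (cCm * m ! *_) (blockSubsets-*-prodFact k (withdraw c b m) mu) ⟩
      cCm * m ! * (F * capacityFact k (withdraw c b m)) ≡⟨ rearrange′ (cCm * m !) F _ ⟩
      (1 * F) * (cCm * m ! * capacityFact k (withdraw c b m)) ≡⟨ cong (1 * F *_) (choose-withdraw k c m b<k m≤cb) ⟩
      1 * F * capacityFact k c
        ≡⟨ cong (λ z → 𝟙 z * F * capacityFact k c) (sym (T⇒≡true (≤⇒≤ᵇ m≤cb))) ⟩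
      𝟙 (m ≤ᵇ c b) * F * capacityFact k c         ∎
      where
      open ≡-Reasoning
      cCm = c b C m
      S = blockSubsets k (withdraw c b m) mu
      F = fillings k (withdraw c b m) mu
      rearrange : ∀ x s y p → x * s * (y * p) ≡ x * y * (s * p)
      rearrange = solve-∀
      rearrange′ : ∀ x f p → x * (f * p) ≡ (1 * f) * (x * p)
      rearrange′ = solve-∀

  -- Colourings of G λ

  occ : List ℕ → ℕ → ℕ
  occ []      y = 0
  occ (x ∷ L) y = 𝟙 (x ≡ᵇ y) + occ L y

  occ-++ : ∀ xs ys y → occ (xs ++ ys) y ≡ occ xs y + occ ys y
  occ-++ []       ys y = refl
  occ-++ (x ∷ xs) ys y = trans (cong (𝟙 (x ≡ᵇ y) +_) (occ-++ xs ys y)) (sym (+-assoc (𝟙 (x ≡ᵇ y)) _ _))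

  select : List ℕ → List Bool → List ℕ
  select []      ms           = []
  select (x ∷ L) []           = []
  select (x ∷ L) (true  ∷ ms) = x ∷ select L ms
  select (x ∷ L) (false ∷ ms) = select L ms

  reject : List ℕ → List Bool → List ℕ
  reject []      ms           = []
  reject (x ∷ L) []           = []
  reject (x ∷ L) (true  ∷ ms) = reject L ms
  reject (x ∷ L) (false ∷ ms) = x ∷ reject L ms

  trues : List Bool → ℕ
  trues []           = 0
  trues (true  ∷ ms) = suc (trues ms)
  trues (false ∷ ms) = trues ms

  falses : List Bool → ℕ
  falses []           = 0
  falses (true  ∷ ms) = falses ms
  falses (false ∷ ms) = suc (falses ms)

  length-select : ∀ L ms → length ms ≡ length L → length (select L ms) ≡ trues ms
  length-select []      []           e = refl
  length-select (x ∷ L) (true  ∷ ms) e = cong suc (length-select L ms (suc-injective e))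
  length-select (x ∷ L) (false ∷ ms) e = length-select L ms (suc-injective e)

  length-reject : ∀ L ms → length ms ≡ length L → length (reject L ms) ≡ falses ms
  length-reject []      []           e = refl
  length-reject (x ∷ L) (true  ∷ ms) e = length-reject L ms (suc-injective e)
  length-reject (x ∷ L) (false ∷ ms) e = cong suc (length-reject L ms (suc-injective e))

  All-select : ∀ {P : ℕ → Set} L ms → All P L → All P (select L ms)
  All-select []      ms           a        = []
  All-select (x ∷ L) []           a        = []
  All-select (x ∷ L) (true  ∷ ms) (px ∷ a) = px ∷ All-select L ms a
  All-select (x ∷ L) (false ∷ ms) (px ∷ a) = All-select L ms a

  All-reject : ∀ {P : ℕ → Set} L ms → All P L → All P (reject L ms)
  All-reject []      ms           a        = []
  All-reject (x ∷ L) []           a        = []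
  All-reject (x ∷ L) (true  ∷ ms) (px ∷ a) = All-reject L ms a
  All-reject (x ∷ L) (false ∷ ms) (px ∷ a) = px ∷ All-reject L ms a

  allMasks : ℕ → List (List Bool)
  allMasks zero    = [] ∷ []
  allMasks (suc N) = map (true ∷_) (allMasks N) ++ map (false ∷_) (allMasks N)

  allMasks-length : ∀ {N ms} → ms ∈ allMasks N → length ms ≡ N
  allMasks-length {zero} (here refl) = refl
  allMasks-length {suc N} p with ∈-++⁻ (map (true ∷_) (allMasks N)) p
  ... | inj₁ q with _ , m , refl ← ∈-map⁻ (true ∷_) q  = cong suc (allMasks-length m)
  ... | inj₂ q with _ , m , refl ← ∈-map⁻ (false ∷_) q = cong suc (allMasks-length m)

  ∑-allMasks-suc : ∀ N (g : List Bool → ℕ) →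
    ∑∈ (allMasks (suc N)) g ≡ ∑[ ms ← allMasks N ] g (true ∷ ms) + ∑[ ms ← allMasks N ] g (false ∷ ms)
  ∑-allMasks-suc N g = trans (∑∈-++ (map (true ∷_) (allMasks N)) _ g)
    (cong₂ _+_ (∑∈-map (true ∷_) (allMasks N) g) (∑∈-map (false ∷_) (allMasks N) g))

  zeroMask : List ℕ → List Bool
  zeroMask []          = []
  zeroMask (zero  ∷ κ) = true ∷ zeroMask κ
  zeroMask (suc _ ∷ κ) = false ∷ zeroMask κ

  lowerColours : List ℕ → List ℕ
  lowerColours []          = []
  lowerColours (zero  ∷ κ) = lowerColours κ
  lowerColours (suc c ∷ κ) = c ∷ lowerColours κ

  insertZeros : List Bool → List ℕ → List ℕ
  insertZeros []           κ       = []
  insertZeros (true  ∷ ms) κ       = 0 ∷ insertZeros ms κ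
  insertZeros (false ∷ ms) []      = []
  insertZeros (false ∷ ms) (c ∷ κ) = suc c ∷ insertZeros ms κ

  zeroMask-insertZeros : ∀ ms κ → length κ ≡ falses ms → zeroMask (insertZeros ms κ) ≡ ms
  zeroMask-insertZeros []           κ       e = refl
  zeroMask-insertZeros (true  ∷ ms) κ       e = cong (true ∷_) (zeroMask-insertZeros ms κ e)
  zeroMask-insertZeros (false ∷ ms) (c ∷ κ) e = cong (false ∷_) (zeroMask-insertZeros ms κ (suc-injective e))

  lowerColours-insertZeros : ∀ ms κ → length κ ≡ falses ms → lowerColours (insertZeros ms κ) ≡ κ
  lowerColours-insertZeros []           []      e = refl
  lowerColours-insertZeros (true  ∷ ms) κ       e = lowerColours-insertZeros ms κ e
  lowerColours-insertZeros (false ∷ ms) (c ∷ κ) e = cong (c ∷_) (lowerColours-insertZeros ms κ (suc-injective e))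

  occ-insertZeros-0 : ∀ ms κ → length κ ≡ falses ms → occ (insertZeros ms κ) 0 ≡ trues ms
  occ-insertZeros-0 []           κ       e = refl
  occ-insertZeros-0 (true  ∷ ms) κ       e = cong suc (occ-insertZeros-0 ms κ e)
  occ-insertZeros-0 (false ∷ ms) (c ∷ κ) e = occ-insertZeros-0 ms κ (suc-injective e)

  occ-suc : ∀ κ j → occ κ (suc j) ≡ occ (lowerColours κ) j
  occ-suc []          j = refl
  occ-suc (zero  ∷ κ) j = occ-suc κ j
  occ-suc (suc c ∷ κ) j = cong (𝟙 (c ≡ᵇ j) +_) (occ-suc κ j)

  lowerColours-< : ∀ ℓ κ → All (_< suc ℓ) κ → All (_< ℓ) (lowerColours κ)
  lowerColours-< ℓ []          a             = []
  lowerColours-< ℓ (zero  ∷ κ) (_ ∷ a)       = lowerColours-< ℓ κ a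
  lowerColours-< ℓ (suc c ∷ κ) (s≤s c<ℓ ∷ a) = c<ℓ ∷ lowerColours-< ℓ κ a

  length-lowerColours : ∀ κ L → length κ ≡ length L → length (lowerColours κ) ≡ length (reject L (zeroMask κ))
  length-lowerColours []          []      e = refl
  length-lowerColours (zero  ∷ κ) (x ∷ L) e = length-lowerColours κ L (suc-injective e)
  length-lowerColours (suc c ∷ κ) (x ∷ L) e = cong suc (length-lowerColours κ L (suc-injective e))

  -- A function into ℓ + 1 colours is its zero mask together with a function
  -- from the remaining points into ℓ colours.
  count-allFuns-by-zeroMask : ∀ (p : List ℕ → Bool) N ℓ →
    countᵇ p (allFuns N (suc ℓ)) ≡ ∑[ ms ← allMasks N ] countᵇ (p ∘ insertZeros ms) (allFuns (falses ms) ℓ)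
  count-allFuns-by-zeroMask p zero ℓ with p []
  ... | true  = refl
  ... | false = refl
  count-allFuns-by-zeroMask p (suc N) ℓ = begin
    countᵇ p (allFuns (suc N) (suc ℓ))
      ≡⟨ countᵇ-allFuns-suc p N (suc ℓ) ⟩
    countᵇ (p ∘ (0 ∷_)) (allFuns N (suc ℓ)) + ∑[ c < ℓ ] countᵇ (p ∘ (suc c ∷_)) (allFuns N (suc ℓ))
      ≡⟨ cong₂ _+_ (count-allFuns-by-zeroMask _ N ℓ) (∑<-cong ℓ (λ c _ → count-allFuns-by-zeroMask _ N ℓ)) ⟩
    zeroFirst + ∑[ c < ℓ ] ∑[ ms ← allMasks N ] nonzeroFirst ms c
      ≡⟨ cong (zeroFirst +_) (sym (∑∈-∑<-comm (allMasks N) ℓ nonzeroFirst)) ⟩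
    zeroFirst + ∑[ ms ← allMasks N ] ∑< ℓ (nonzeroFirst ms)
      ≡⟨ cong (zeroFirst +_) (∑∈-cong (allMasks N) (λ ms _ →
           sym (countᵇ-allFuns-suc (p ∘ insertZeros (false ∷ ms)) (falses ms) ℓ))) ⟩
    zeroFirst + ∑[ ms ← allMasks N ] perMask (false ∷ ms)
      ≡⟨ sym (∑-allMasks-suc N perMask) ⟩
    ∑∈ (allMasks (suc N)) perMask ∎
    where
    open ≡-Reasoning
    perMask : List Bool → ℕ
    perMask ms = countᵇ (p ∘ insertZeros ms) (allFuns (falses ms) ℓ)
    zeroFirst : ℕ
    zeroFirst = ∑[ ms ← allMasks N ] perMask (true ∷ ms)
    nonzeroFirst : List Bool → ℕ → ℕ
    nonzeroFirst ms c = countᵇ (λ κ → p (suc c ∷ insertZeros ms κ)) (allFuns (falses ms) ℓ)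

  addOne : ℕ → (ℕ → ℕ) → (ℕ → ℕ)
  addOne x c y = 𝟙 (x ≡ᵇ y) + c y

  Extensional : ((ℕ → ℕ) → ℕ) → Set
  Extensional H = ∀ {c c′} → (∀ y → c y ≡ c′ y) → H c ≡ H c′

  withdraw-zero : ∀ c b y → withdraw c b 0 y ≡ c y
  withdraw-zero c b y with y ≡ᵇ b
  ... | true  = refl
  ... | false = refl

  addOne-withdraw-other : ∀ {x b} → x ≢ b → ∀ c m y → addOne x (withdraw c b m) y ≡ withdraw (addOne x c) b m y
  addOne-withdraw-other {x} {b} x≢b c m y with y ≟ b
  ... | yes refl rewrite ≢⇒≡ᵇ-false x≢b | withdraw-same c y m = refl
  ... | no y≢b   rewrite withdraw-other c m y≢b = sym (withdraw-other (addOne x c) m y≢b)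

  addOne-withdraw-same : ∀ c b m → m ≤ c b → ∀ y → addOne b (withdraw c b m) y ≡ withdraw (addOne b c) b m y
  addOne-withdraw-same c b m m≤cb y with y ≟ b
  ... | yes refl rewrite withdraw-same c y m | withdraw-same (addOne y c) y m | ≡ᵇ-refl y = sym (+-∸-assoc 1 m≤cb)
  ... | no y≢b   rewrite withdraw-other c m y≢b = sym (withdraw-other (addOne b c) m y≢b)

  withdraw-addOne-suc : ∀ c b m y → withdraw c b m y ≡ withdraw (addOne b c) b (suc m) y
  withdraw-addOne-suc c b m y with y ≟ b
  ... | yes refl rewrite withdraw-same c y m | withdraw-same (addOne y c) y (suc m) | ≡ᵇ-refl y = refl
  ... | no y≢b   rewrite withdraw-other c m y≢b | withdraw-other (addOne b c) (suc m) y≢b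
                       | ≢⇒≡ᵇ-false (y≢b ∘ sym) = refl

  allEqualTo : ℕ → List ℕ → Bool
  allEqualTo b = all (_≡ᵇ b)

  chosen : List ℕ → ℕ → ℕ → List Bool → Bool
  chosen L b m ms = (trues ms ≡ᵇ m) ∧ allEqualTo b (select L ms)

  -- Split on whether the first vertex is chosen; Pascal's rule recombines the cases.
  ∑-chosen-masks : ∀ L b m (H : (ℕ → ℕ) → ℕ) → Extensional H →
    ∑[ ms ← allMasks (length L) ] (𝟙 (chosen L b m ms) * H (occ (reject L ms)))
      ≡ (occ L b C m) * H (withdraw (occ L) b m)
  ∑-chosen-masks []      b zero    H ext = trans (+-identityʳ _) (trans (+-identityʳ _)
                                             (sym (trans (+-identityʳ _) (ext (withdraw-zero (λ _ → 0) b)))))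
  ∑-chosen-masks []      b (suc m) H ext = refl
  ∑-chosen-masks (x ∷ L) b m H ext =
    trans (∑-allMasks-suc (length L) _)
      (trans (cong (∑[ ms ← allMasks (length L) ] (𝟙 (chosen (x ∷ L) b m (true ∷ ms)) * H (occ (reject L ms))) +_)
                   (∑-chosen-masks L b m (H ∘ addOne x) (λ e → ext (λ y → cong (𝟙 (x ≡ᵇ y) +_) (e y)))))
             (step m (x ≟ b)))
    where
    masks = allMasks (length L)
    step : ∀ m → Dec (x ≡ b) →
      ∑[ ms ← masks ] (𝟙 (chosen (x ∷ L) b m (true ∷ ms)) * H (occ (reject L ms)))
        + (occ L b C m) * H (addOne x (withdraw (occ L) b m))
      ≡ (occ (x ∷ L) b C m) * H (withdraw (occ (x ∷ L)) b m)
    step zero _ rewrite ∑∈-zero masks =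
      cong (_+ 0) (ext (λ y → trans (cong (𝟙 (x ≡ᵇ y) +_) (withdraw-zero (occ L) b y))
                                    (sym (withdraw-zero (occ (x ∷ L)) b y))))
    step (suc m) (no x≢b) rewrite ≢⇒≡ᵇ-false x≢b =
      cong₂ _+_ (trans (∑∈-cong masks (λ ms _ → cong (λ z → 𝟙 z * H (occ (reject L ms))) (∧-zeroʳ (trues ms ≡ᵇ m))))
                       (∑∈-zero masks))
                (cong ((occ L b C suc m) *_) (ext (addOne-withdraw-other x≢b (occ L) (suc m))))
    step (suc m) (yes refl) rewrite ≡ᵇ-refl x =
      trans (cong₂ _+_ (trans (∑-chosen-masks L x m H ext)
                              (cong ((occ L x C m) *_) (ext (withdraw-addOne-suc (occ L) x m))))
                       (largerPart (suc m ≤? occ L x)))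
        (trans (sym (*-distribʳ-+ _ (occ L x C m) (occ L x C suc m)))
               (cong (_* H (withdraw (addOne x (occ L)) x (suc m))) (nCk+nC[k+1]≡[n+1]C[k+1] (occ L x) m)))
      where
      largerPart : Dec (suc m ≤ occ L x) →
        (occ L x C suc m) * H (addOne x (withdraw (occ L) x (suc m)))
          ≡ (occ L x C suc m) * H (withdraw (addOne x (occ L)) x (suc m))
      largerPart (yes m<occ) = cong ((occ L x C suc m) *_) (ext (addOne-withdraw-same (occ L) x (suc m) m<occ))
      largerPart (no m≮occ) rewrite k>n⇒nCk≡0 (≰⇒> m≮occ) = refl

  allEqual : List ℕ → Bool
  allEqual []       = true
  allEqual (x ∷ xs) = allEqualTo x (x ∷ xs)

  -- Proper colourings of G λ with content μ, recursively: colour 0 takes m vertices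
  -- of one block, and the other vertices are coloured with the remaining colours.
  validColouring : List ℕ → List ℕ → List ℕ → Bool
  validColouring L []       κ = true
  validColouring L (m ∷ mu) κ =
    ((occ κ 0 ≡ᵇ m) ∧ allEqual (select L (zeroMask κ))) ∧ validColouring (reject L (zeroMask κ)) mu (lowerColours κ)

  chosenInOneBlock : List ℕ → ℕ → List Bool → Bool
  chosenInOneBlock L m ms = (trues ms ≡ᵇ m) ∧ allEqual (select L ms)

  colourings : List ℕ → List ℕ → ℕ
  colourings L mu = countᵇ (validColouring L mu) (allFuns (length L) (length mu))

  validColouring-insertZeros : ∀ L m mu ms κ → length κ ≡ falses ms →
    validColouring L (m ∷ mu) (insertZeros ms κ) ≡ chosenInOneBlock L m ms ∧ validColouring (reject L ms) mu κ
  validColouring-insertZeros L m mu ms κ e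
    rewrite occ-insertZeros-0 ms κ e | zeroMask-insertZeros ms κ e | lowerColours-insertZeros ms κ e = refl

  𝟙-chosenInOneBlock≡∑ : ∀ k m L ms → 0 < m → length ms ≡ length L → All (_< k) L →
    𝟙 (chosenInOneBlock L m ms) ≡ ∑[ b < k ] 𝟙 (chosen L b m ms)
  𝟙-chosenInOneBlock≡∑ k m L ms 0<m e L<k with trues ms ≟ m
  ... | no t≢m rewrite ≢⇒≡ᵇ-false t≢m = sym (∑<-zero k (λ _ _ → refl))
  ... | yes t≡m rewrite T⇒≡true (≡⇒≡ᵇ _ _ t≡m) =
    nonEmpty (select L ms) (length-select L ms e) (All-select L ms L<k)
    where
    nonEmpty : ∀ xs → length xs ≡ trues ms → All (_< k) xs → 𝟙 (allEqual xs) ≡ ∑[ b < k ] 𝟙 (allEqualTo b xs)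
    nonEmpty []       l≡t _         = ⊥-elim (<⇒≢ 0<m (trans l≡t t≡m))
    nonEmpty (y ∷ ys) _   (y<k ∷ _) =
      sym (∑<-single k _ y<k (λ i _ i≢y → cong (λ z → 𝟙 (z ∧ allEqualTo i ys)) (≢⇒≡ᵇ-false (i≢y ∘ sym))))

  blockSubsets-cong : ∀ k mu {c c′} → (∀ y → y < k → c y ≡ c′ y) → blockSubsets k c mu ≡ blockSubsets k c′ mu
  blockSubsets-cong k []       e = cong 𝟙 (allBelow-cong k (λ i i<k → cong (0 ≡ᵇ_) (e i i<k)))
  blockSubsets-cong k (m ∷ mu) e = ∑<-cong k (λ b b<k → cong₂ _*_ (cong (_C m) (e b b<k))
    (blockSubsets-cong k mu (λ y y<k → cong (λ z → if y ≡ᵇ _ then z ∸ m else z) (e y y<k))))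

  colourings≡blockSubsets : ∀ k mu → All (0 <_) mu → ∀ L → All (_< k) L →
    colourings L mu ≡ blockSubsets k (occ L) mu
  colourings≡blockSubsets k [] _ []      _ = cong 𝟙 (sym (allBelow-const-true k))
  colourings≡blockSubsets k [] _ (x ∷ L) (x<k ∷ _) =
    cong 𝟙 (sym (allBelow-false k _ x<k (cong (λ z → 0 ≡ᵇ z + occ L x) (cong 𝟙 (≡ᵇ-refl x)))))
  colourings≡blockSubsets k (m ∷ mu) (0<m ∷ 0<mu) L L<k = begin
    colourings L (m ∷ mu)
      ≡⟨ count-allFuns-by-zeroMask (validColouring L (m ∷ mu)) (length L) (length mu) ⟩
    ∑[ ms ← masks ] countᵇ (validColouring L (m ∷ mu) ∘ insertZeros ms) (allFuns (falses ms) (length mu))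
      ≡⟨ ∑∈-cong masks perMask ⟩
    ∑[ ms ← masks ] (𝟙 (chosenInOneBlock L m ms) * blockSubsets k (occ (reject L ms)) mu)
      ≡⟨ ∑∈-cong masks (λ ms ms∈ → cong (_* _) (𝟙-chosenInOneBlock≡∑ k m L ms 0<m (allMasks-length ms∈) L<k)) ⟩
    ∑[ ms ← masks ] (∑[ b < k ] 𝟙 (chosen L b m ms) * blockSubsets k (occ (reject L ms)) mu)
      ≡⟨ ∑∈-cong masks (λ ms _ → sym (∑<-*ʳ k _ _)) ⟩
    ∑[ ms ← masks ] ∑[ b < k ] (𝟙 (chosen L b m ms) * blockSubsets k (occ (reject L ms)) mu)
      ≡⟨ ∑∈-∑<-comm masks k _ ⟩
    ∑[ b < k ] ∑[ ms ← masks ] (𝟙 (chosen L b m ms) * blockSubsets k (occ (reject L ms)) mu)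
      ≡⟨ ∑<-cong k (λ b _ → ∑-chosen-masks L b m (λ c → blockSubsets k c mu)
                                            (λ e → blockSubsets-cong k mu (λ y _ → e y))) ⟩
    blockSubsets k (occ L) (m ∷ mu) ∎
    where
    open ≡-Reasoning
    masks = allMasks (length L)
    perMask : ∀ ms → ms ∈ masks →
      countᵇ (validColouring L (m ∷ mu) ∘ insertZeros ms) (allFuns (falses ms) (length mu))
        ≡ 𝟙 (chosenInOneBlock L m ms) * blockSubsets k (occ (reject L ms)) mu
    perMask ms ms∈ = begin
      countᵇ (validColouring L (m ∷ mu) ∘ insertZeros ms) (allFuns (falses ms) (length mu))
        ≡⟨ countᵇ-cong (allFuns (falses ms) (length mu))
             (λ κ κ∈ → validColouring-insertZeros L m mu ms κ (proj₁ (allFuns-shape κ∈))) ⟩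
      countᵇ (λ κ → first ∧ validColouring (reject L ms) mu κ) (allFuns (falses ms) (length mu))
        ≡⟨ countᵇ-∧ first (validColouring (reject L ms) mu) (allFuns (falses ms) (length mu)) ⟩
      𝟙 first * countᵇ (validColouring (reject L ms) mu) (allFuns (falses ms) (length mu))
        ≡⟨ cong (λ n → 𝟙 first * countᵇ (validColouring (reject L ms) mu) (allFuns n (length mu)))
                (sym (length-reject L ms (allMasks-length ms∈))) ⟩
      𝟙 first * colourings (reject L ms) mu
        ≡⟨ cong (𝟙 first *_) (colourings≡blockSubsets k mu 0<mu (reject L ms) (All-reject L ms L<k)) ⟩
      𝟙 first * blockSubsets k (occ (reject L ms)) mu ∎
      where
      first = chosenInOneBlock L m ms

  Paired : List ℕ → List ℕ → ℕ → ℕ → Set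
  Paired (c′ ∷ κ) (x′ ∷ L) c x = (c′ ≡ c × x′ ≡ x) ⊎ Paired κ L c x
  Paired _        _        _ _ = ⊥

  ClassesMonochromatic : List ℕ → List ℕ → Set
  ClassesMonochromatic L κ = ∀ c x y → Paired κ L c x → Paired κ L c y → x ≡ y

  ContentIs : List ℕ → List ℕ → Set
  ContentIs mu κ = ∀ j → j < length mu → occ κ j ≡ at mu j

  paired-0⇒∈select : ∀ κ L {x} → Paired κ L 0 x → x ∈ select L (zeroMask κ)
  paired-0⇒∈select (zero  ∷ κ) (_ ∷ L) (inj₁ (refl , refl)) = here refl
  paired-0⇒∈select (zero  ∷ κ) (_ ∷ L) (inj₂ p)             = there (paired-0⇒∈select κ L p)
  paired-0⇒∈select (suc c ∷ κ) (_ ∷ L) (inj₁ (() , _))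
  paired-0⇒∈select (suc c ∷ κ) (_ ∷ L) (inj₂ p)             = paired-0⇒∈select κ L p

  ∈select⇒paired-0 : ∀ κ L {x} → x ∈ select L (zeroMask κ) → Paired κ L 0 x
  ∈select⇒paired-0 (zero  ∷ κ) (_ ∷ L) (here refl) = inj₁ (refl , refl)
  ∈select⇒paired-0 (zero  ∷ κ) (_ ∷ L) (there p)   = inj₂ (∈select⇒paired-0 κ L p)
  ∈select⇒paired-0 (suc c ∷ κ) (_ ∷ L) p           = inj₂ (∈select⇒paired-0 κ L p)

  paired-suc⇒lowered : ∀ κ L {c x} → Paired κ L (suc c) x → Paired (lowerColours κ) (reject L (zeroMask κ)) c x
  paired-suc⇒lowered (zero   ∷ κ) (_ ∷ L) (inj₁ (() , _))
  paired-suc⇒lowered (zero   ∷ κ) (_ ∷ L) (inj₂ p)             = paired-suc⇒lowered κ L p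
  paired-suc⇒lowered (suc c′ ∷ κ) (_ ∷ L) (inj₁ (refl , refl)) = inj₁ (refl , refl)
  paired-suc⇒lowered (suc c′ ∷ κ) (_ ∷ L) (inj₂ p)             = inj₂ (paired-suc⇒lowered κ L p)

  lowered⇒paired-suc : ∀ κ L {c x} → length κ ≡ length L →
    Paired (lowerColours κ) (reject L (zeroMask κ)) c x → Paired κ L (suc c) x
  lowered⇒paired-suc (zero   ∷ κ) (_ ∷ L) e p                    = inj₂ (lowered⇒paired-suc κ L (suc-injective e) p)
  lowered⇒paired-suc (suc c′ ∷ κ) (_ ∷ L) e (inj₁ (refl , refl)) = inj₁ (refl , refl)
  lowered⇒paired-suc (suc c′ ∷ κ) (_ ∷ L) e (inj₂ p)             = inj₂ (lowered⇒paired-suc κ L (suc-injective e) p)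

  allEqualTo-sound : ∀ b xs → T (allEqualTo b xs) → ∀ {x} → x ∈ xs → x ≡ b
  allEqualTo-sound b xs t x∈ = ≡ᵇ⇒≡ _ b (T-all-elim (_≡ᵇ b) xs t x∈)

  allEqual-sound : ∀ xs → T (allEqual xs) → ∀ {x y} → x ∈ xs → y ∈ xs → x ≡ y
  allEqual-sound (z ∷ xs) t x∈ y∈ =
    trans (allEqualTo-sound z (z ∷ xs) t x∈) (sym (allEqualTo-sound z (z ∷ xs) t y∈))

  allEqual-complete : ∀ xs → (∀ {x y} → x ∈ xs → y ∈ xs → x ≡ y) → T (allEqual xs)
  allEqual-complete []       h = tt
  allEqual-complete (z ∷ xs) h = T-all-intro (_≡ᵇ z) (z ∷ xs) (λ x∈ → ≡⇒≡ᵇ _ z (h x∈ (here refl)))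

  validColouring-sound : ∀ mu L κ → All (_< length mu) κ → length κ ≡ length L → T (validColouring L mu κ) →
    ClassesMonochromatic L κ × ContentIs mu κ
  validColouring-sound []       L []      a       e t = (λ _ _ _ ()) , (λ _ ())
  validColouring-sound []       L (_ ∷ κ) (() ∷ _) e t
  validColouring-sound (m ∷ mu) L κ       a       e t = monochromatic , content
    where
    colour0 = T-∧-left t
    rest    = validColouring-sound mu (reject L (zeroMask κ)) (lowerColours κ)
                (lowerColours-< (length mu) κ a) (length-lowerColours κ L e) (T-∧-right {(occ κ 0 ≡ᵇ m) ∧ _} t)
    monochromatic : ClassesMonochromatic L κ
    monochromatic zero    x y px py =
      allEqual-sound _ (T-∧-right {occ κ 0 ≡ᵇ m} colour0) (paired-0⇒∈select κ L px) (paired-0⇒∈select κ L py)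
    monochromatic (suc c) x y px py = proj₁ rest c x y (paired-suc⇒lowered κ L px) (paired-suc⇒lowered κ L py)
    content : ContentIs (m ∷ mu) κ
    content zero    _       = ≡ᵇ⇒≡ _ _ (T-∧-left colour0)
    content (suc j) (s≤s p) = trans (occ-suc κ j) (proj₂ rest j p)

  validColouring-complete : ∀ mu L κ → All (_< length mu) κ → length κ ≡ length L →
    ClassesMonochromatic L κ → ContentIs mu κ → T (validColouring L mu κ)
  validColouring-complete []       L κ a e mono content = tt
  validColouring-complete (m ∷ mu) L κ a e mono content =
    T-∧-intro (T-∧-intro (≡⇒≡ᵇ _ _ (content 0 (s≤s z≤n)))
                         (allEqual-complete _ (λ x∈ y∈ →
                           mono 0 _ _ (∈select⇒paired-0 κ L x∈) (∈select⇒paired-0 κ L y∈))))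
      (validColouring-complete mu (reject L (zeroMask κ)) (lowerColours κ)
        (lowerColours-< (length mu) κ a) (length-lowerColours κ L e)
        (λ c x y px py → mono (suc c) x y (lowered⇒paired-suc κ L e px) (lowered⇒paired-suc κ L e py))
        (λ j j< → trans (sym (occ-suc κ j)) (content (suc j) (s≤s j<))))

  paired⇒vertex : ∀ κ L {c x} → Paired κ L c x → Σ (Fin (length L)) λ v → at κ (toℕ v) ≡ c × lookup L v ≡ x
  paired⇒vertex (_ ∷ κ) (_ ∷ L) (inj₁ (e₁ , e₂)) = fzero , e₁ , e₂
  paired⇒vertex (_ ∷ κ) (_ ∷ L) (inj₂ p) with v , e₁ , e₂ ← paired⇒vertex κ L p = fsuc v , e₁ , e₂

  vertex⇒paired : ∀ κ L → length κ ≡ length L → (v : Fin (length L)) → Paired κ L (at κ (toℕ v)) (lookup L v)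
  vertex⇒paired (_ ∷ κ) (_ ∷ L) e fzero    = inj₁ (refl , refl)
  vertex⇒paired (_ ∷ κ) (_ ∷ L) e (fsuc v) = inj₂ (vertex⇒paired κ L (suc-injective e) v)

  sameBlock-or-differentColour⇒ : ∀ a b → T (not (not a) ∨ not b) → T b → T a
  sameBlock-or-differentColour⇒ true  b     _ _ = tt
  sameBlock-or-differentColour⇒ false true  () _
  sameBlock-or-differentColour⇒ false false _  ()

  ⇒sameBlock-or-differentColour : ∀ a b → (T b → T a) → T (not (not a) ∨ not b)
  ⇒sameBlock-or-differentColour true  b     _ = tt
  ⇒sameBlock-or-differentColour false true  h = h tt
  ⇒sameBlock-or-differentColour false false _ = tt

  isProper⇒monochromatic : ∀ lam κ → length κ ≡ length (blockLabels lam) →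
    T (isProper (G lam) κ) → ClassesMonochromatic (blockLabels lam) κ
  isProper⇒monochromatic lam κ e t c x y px py
    with v , cv , xv ← paired⇒vertex κ (blockLabels lam) px | w , cw , yw ← paired⇒vertex κ (blockLabels lam) py =
    trans (sym xv) (trans (≡ᵇ⇒≡ _ _ (sameBlock-or-differentColour⇒ _ _ edge (≡⇒≡ᵇ _ _ (trans cv (sym cw))))) yw)
    where
    L = blockLabels lam
    edge = T-all-elim _ (allFin (length L)) (T-all-elim _ (allFin (length L)) t (∈-allFin v)) (∈-allFin w)

  monochromatic⇒isProper : ∀ lam κ → length κ ≡ length (blockLabels lam) →
    ClassesMonochromatic (blockLabels lam) κ → T (isProper (G lam) κ)
  monochromatic⇒isProper lam κ e mono =
    T-all-intro _ (allFin (length L)) (λ {v} _ → T-all-intro _ (allFin (length L)) (λ {w} _ → ⇒sameBlock-or-differentColour _ _ (λ t →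
      ≡⇒≡ᵇ _ _ (mono _ _ _ (vertex⇒paired κ L e v)
                          (subst (λ z → Paired κ L z (lookup L w)) (sym (≡ᵇ⇒≡ _ _ t)) (vertex⇒paired κ L e w))))))
    where
    L = blockLabels lam

  hasContent≡allBelow : ∀ mu κ → hasContent (length κ) mu κ ≡ allBelow (length mu) (λ j → occ κ j ≡ᵇ at mu j)
  hasContent≡allBelow mu κ = trans (all-upTo (length mu) _)
    (allBelow-cong (length mu) (λ j _ → cong (_≡ᵇ at mu j)
      (trans (countᵇ-≡-∑ _ (upTo (length κ))) (trans (∑∈-applyUpTo id (length κ) _) (occ-as-∑ κ j)))))
    where
    occ-as-∑ : ∀ κ j → ∑[ v < length κ ] 𝟙 (at κ v ≡ᵇ j) ≡ occ κ j
    occ-as-∑ []      j = refl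
    occ-as-∑ (c ∷ κ) j = cong (𝟙 (c ≡ᵇ j) +_) (occ-as-∑ κ j)

  coeffMr≡colourings : ∀ lam mu → coeffMr lam mu ≡ colourings (blockLabels lam) mu
  coeffMr≡colourings lam mu =
    countᵇ-cong (allFuns (length L) (length mu)) (λ κ κ∈ → pointwise κ (allFuns-shape κ∈))
    where
    L = blockLabels lam
    pointwise : ∀ κ → length κ ≡ length L × All (_< length mu) κ →
      (isProper (G lam) κ ∧ hasContent (length L) mu κ) ≡ validColouring L mu κ
    pointwise κ (e , a) =
      trans (cong (isProper (G lam) κ ∧_) (trans (cong (λ n → hasContent n mu κ) (sym e)) (hasContent≡allBelow mu κ)))
      (T-⇔⇒≡
      (λ t → validColouring-complete mu L κ a e (isProper⇒monochromatic lam κ e (T-∧-left t))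
               (λ j j< → ≡ᵇ⇒≡ _ _ (allBelow-elim (length mu) _ (T-∧-right {isProper (G lam) κ} t) j j<)))
      (λ t → let mono , content = validColouring-sound mu L κ a e t in
        T-∧-intro (monochromatic⇒isProper lam κ e mono)
                  (allBelow-intro (length mu) _ (λ j j< → ≡⇒≡ᵇ _ _ (content j j<)))))

  occ-replicate-same : ∀ l i → occ (replicate l i) i ≡ l
  occ-replicate-same zero    i = refl
  occ-replicate-same (suc l) i rewrite ≡ᵇ-refl i = cong suc (occ-replicate-same l i)

  occ-replicate-other : ∀ l {i y} → i ≢ y → occ (replicate l i) y ≡ 0
  occ-replicate-other zero    i≢y = refl
  occ-replicate-other (suc l) i≢y rewrite ≢⇒≡ᵇ-false i≢y = occ-replicate-other l i≢y

  All-replicate : ∀ {P : ℕ → Set} l {i} → P i → All P (replicate l i)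
  All-replicate zero    p = []
  All-replicate (suc l) p = p ∷ All-replicate l p

  blockLabelsFrom-< : ∀ i lam → All (_< i + length lam) (blockLabelsFrom i lam)
  blockLabelsFrom-< i []        = []
  blockLabelsFrom-< i (l ∷ lam) = ++⁺ (All-replicate l (m<m+n i (s≤s z≤n)))
    (subst (λ z → All (_< z) (blockLabelsFrom (suc i) lam)) (sym (+-suc i (length lam))) (blockLabelsFrom-< (suc i) lam))

  occ-blockLabelsFrom-below : ∀ i lam {y} → y < i → occ (blockLabelsFrom i lam) y ≡ 0
  occ-blockLabelsFrom-below i []        y<i = refl
  occ-blockLabelsFrom-below i (l ∷ lam) y<i = trans (occ-++ (replicate l i) _ _)
    (cong₂ _+_ (occ-replicate-other l (<⇒≢ y<i ∘ sym)) (occ-blockLabelsFrom-below (suc i) lam (m<n⇒m<1+n y<i)))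

  occ-blockLabelsFrom : ∀ i lam y → occ (blockLabelsFrom i lam) (i + y) ≡ at lam y
  occ-blockLabelsFrom i []        y       = refl
  occ-blockLabelsFrom i (l ∷ lam) zero    rewrite +-identityʳ i = trans (occ-++ (replicate l i) _ i)
    (trans (cong₂ _+_ (occ-replicate-same l i) (occ-blockLabelsFrom-below (suc i) lam (n<1+n i))) (+-identityʳ l))
  occ-blockLabelsFrom i (l ∷ lam) (suc y) = trans (occ-++ (replicate l i) _ (i + suc y))
    (cong₂ _+_ (occ-replicate-other l (<⇒≢ (m<m+n i (s≤s z≤n))))
               (trans (cong (occ (blockLabelsFrom (suc i) lam)) (+-suc i y)) (occ-blockLabelsFrom (suc i) lam y)))

  capacityFact-at : ∀ lam → capacityFact (length lam) (at lam) ≡ prodFact lam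
  capacityFact-at []        = refl
  capacityFact-at (l ∷ lam) = cong (l ! *_) (capacityFact-at lam)

  coeffMr-*-prodFact : ∀ lam mu → All (0 <_) mu → coeffMr lam mu * prodFact mu ≡ coeffMp mu lam * prodFact lam
  coeffMr-*-prodFact lam mu 0<mu = begin
    coeffMr lam mu * prodFact mu                                        ≡⟨ cong (_* prodFact mu) (coeffMr≡colourings lam mu) ⟩
    colourings (blockLabels lam) mu * prodFact mu                       ≡⟨ cong (_* prodFact mu) colourings≡ ⟩
    blockSubsets (length lam) (at lam) mu * prodFact mu                 ≡⟨ blockSubsets-*-prodFact (length lam) (at lam) mu ⟩
    fillings (length lam) (at lam) mu * capacityFact (length lam) (at lam) ≡⟨ cong₂ _*_ (sym (coeffMp≡fillings mu lam))
                                                                                          (capacityFact-at lam) ⟩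
    coeffMp mu lam * prodFact lam                                       ∎
    where
    open ≡-Reasoning
    colourings≡ : colourings (blockLabels lam) mu ≡ blockSubsets (length lam) (at lam) mu
    colourings≡ = trans (colourings≡blockSubsets (length lam) mu 0<mu (blockLabels lam) (blockLabelsFrom-< 0 lam))
                        (blockSubsets-cong (length lam) mu (λ y _ → occ-blockLabelsFrom 0 lam y))

  -- Puzzles

  Sorted : List ℕ → Set
  Sorted = Linked (λ a b → b ≤ a)

  Sorted-tail : ∀ {y ys} → Sorted (y ∷ ys) → Sorted ys
  Sorted-tail = Data.List.Relation.Unary.Linked.tail

  Sorted-head-max : ∀ {y ys} → Sorted (y ∷ ys) → All (_≤ y) ys
  Sorted-head-max s with ys≤y ∷ _ ← Linked⇒AllPairs (λ b≤a c≤b → ≤-trans c≤b b≤a) s = ys≤y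

  Sorted-∷ : ∀ {m ys} → All (_≤ m) ys → Sorted ys → Sorted (m ∷ ys)
  Sorted-∷ []          _ = [-]
  Sorted-∷ (y≤m ∷ _) s = y≤m ∷ s

  mult≡occ : ∀ i ν → mult i ν ≡ occ ν i
  mult≡occ i []      = refl
  mult≡occ i (a ∷ ν) with a ≡ᵇ i
  ... | true  = cong suc (mult≡occ i ν)
  ... | false = mult≡occ i ν

  occ-above : ∀ ν {B x} → All (_≤ B) ν → B < x → occ ν x ≡ 0
  occ-above []      _          _   = refl
  occ-above (y ∷ ν) {x = x} (y≤B ∷ ν≤B) B<x =
    trans (cong (λ z → 𝟙 z + occ ν x) (≢⇒≡ᵇ-false (<⇒≢ (≤-<-trans y≤B B<x)))) (occ-above ν ν≤B B<x)

  multFactBelow : List ℕ → ℕ → ℕ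
  multFactBelow ν B = ∏[ i < B ] (occ ν (suc i) !)

  multFact≡multFactBelow : ∀ ν → multFact ν ≡ multFactBelow ν (sum ν)
  multFact≡multFactBelow ν = trans (go id (sum ν)) (∏<-cong (sum ν) (λ i _ → cong _! (mult≡occ (suc i) ν)))
    where
    go : ∀ f B → prodFact (map (λ i → mult (suc i) ν) (applyUpTo f B)) ≡ ∏[ i < B ] (mult (suc (f i)) ν !)
    go f zero    = refl
    go f (suc B) = cong (mult (suc (f 0)) ν ! *_) (go (f ∘ suc) B)

  multFactBelow-+ : ∀ ν B e → All (_≤ B) ν → multFactBelow ν (B + e) ≡ multFactBelow ν B
  multFactBelow-+ ν B zero    ν≤B = cong (multFactBelow ν) (+-identityʳ B)
  multFactBelow-+ ν B (suc e) ν≤B = begin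
    multFactBelow ν (B + suc e)                      ≡⟨ cong (multFactBelow ν) (+-suc B e) ⟩
    multFactBelow ν (suc (B + e))                    ≡⟨ ∏<-snoc (B + e) (λ i → occ ν (suc i) !) ⟩
    multFactBelow ν (B + e) * occ ν (suc (B + e)) !  ≡⟨ cong (λ z → multFactBelow ν (B + e) * z !)
                                                          (occ-above ν ν≤B (s≤s (m≤m+n B e))) ⟩
    multFactBelow ν (B + e) * 1                      ≡⟨ *-identityʳ _ ⟩
    multFactBelow ν (B + e)                          ≡⟨ multFactBelow-+ ν B e ν≤B ⟩
    multFactBelow ν B                                ∎
    where open ≡-Reasoning

  multFactBelow-bound-irrelevant : ∀ ν {B B′} → All (_≤ B) ν → All (_≤ B′) ν →
    multFactBelow ν B ≡ multFactBelow ν B′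
  multFactBelow-bound-irrelevant ν {B} {B′} ν≤B ν≤B′ =
    trans (sym (multFactBelow-+ ν B B′ ν≤B))
          (trans (cong (multFactBelow ν) (+-comm B B′)) (multFactBelow-+ ν B′ B ν≤B′))

  All-≤-sum : ∀ ν → All (_≤ sum ν) ν
  All-≤-sum []      = []
  All-≤-sum (x ∷ ν) = m≤m+n x (sum ν) ∷ All-map (λ p → ≤-trans p (m≤n+m (sum ν) x)) (All-≤-sum ν)

  -- Prepending a largest part m only changes the factor n_m(ν)!, which grows
  -- to (n_m(ν) + 1)!.
  multFact-∷-max : ∀ m ν → 0 < m → All (_≤ m) ν → multFact (m ∷ ν) ≡ multFact ν * occ (m ∷ ν) m
  multFact-∷-max (suc m′) ν _ ν≤m = begin
    multFact (m ∷ ν)                   ≡⟨ multFact≡multFactBelow (m ∷ ν) ⟩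
    multFactBelow (m ∷ ν) (sum (m ∷ ν)) ≡⟨ multFactBelow-bound-irrelevant (m ∷ ν) (All-≤-sum (m ∷ ν)) (≤-refl ∷ ν≤m) ⟩
    multFactBelow (m ∷ ν) m            ≡⟨ *-cancelʳ-≡ _ _ (occ ν m !) {{occ ν m !≢0}} (trans grow rearrange) ⟩
    multFactBelow ν m * suc (occ ν m)  ≡⟨ cong₂ _*_ (trans (multFactBelow-bound-irrelevant ν ν≤m (All-≤-sum ν))
                                                           (sym (multFact≡multFactBelow ν)))
                                                    (cong (_+ occ ν m) (sym (cong 𝟙 (≡ᵇ-refl m)))) ⟩
    multFact ν * occ (m ∷ ν) m         ∎
    where
    open ≡-Reasoning
    m = suc m′
    grow : multFactBelow (m ∷ ν) m * occ ν m ! ≡ multFactBelow ν m * occ (m ∷ ν) m !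
    grow = ∏<-update m (λ i → occ (m ∷ ν) (suc i) !) (λ i → occ ν (suc i) !) ≤-refl
      (λ i _ i≢m′ → cong (λ z → (z + occ ν (suc i)) !) (cong 𝟙 (≢⇒≡ᵇ-false (i≢m′ ∘ sym ∘ suc-injective))))
    rearrange : multFactBelow ν m * occ (m ∷ ν) m ! ≡ multFactBelow ν m * suc (occ ν m) * occ ν m !
    rearrange rewrite ≡ᵇ-refl m = sym (*-assoc (multFactBelow ν m) (suc (occ ν m)) (occ ν m !))

  partsIn : List ℕ → List ℕ → ℕ → List ℕ
  partsIn (m ∷ mu) (c ∷ f) b = if c ≡ᵇ b then m ∷ partsIn mu f b else partsIn mu f b
  partsIn _        _       _ = []

  -- The puzzle induced by an assignment f of the parts of μ to the k blocks.
  puzzleOf : ℕ → List ℕ → List ℕ → List (List ℕ)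
  puzzleOf k mu f = applyUpTo (partsIn mu f) k

  _==_ : List (List ℕ) → List (List ℕ) → Bool
  xs == ys = does (≡-dec (≡-dec _≟_) xs ys)

  ==-sound : ∀ {xs ys} → T (xs == ys) → xs ≡ ys
  ==-sound {xs} {ys} t with ≡-dec (≡-dec _≟_) xs ys
  ... | yes e = e

  ==-complete : ∀ {xs ys} → xs ≡ ys → T (xs == ys)
  ==-complete {xs} {ys} e with ≡-dec (≡-dec _≟_) xs ys
  ... | yes _   = tt
  ... | no  x≢y = x≢y e

  fibre : ℕ → List ℕ → List (List ℕ) → ℕ
  fibre k mu ps = countᵇ (λ f → puzzleOf k mu f == ps) (allFuns (length mu) k)

  pushAt : ℕ → ℕ → List (List ℕ) → List (List ℕ)
  pushAt c       m []       = []
  pushAt zero    m (x ∷ xs) = (m ∷ x) ∷ xs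
  pushAt (suc c) m (x ∷ xs) = x ∷ pushAt c m xs

  popAt : ℕ → List (List ℕ) → List (List ℕ)
  popAt c       []             = []
  popAt zero    ([] ∷ xs)      = [] ∷ xs
  popAt zero    ((y ∷ x) ∷ xs) = x ∷ xs
  popAt (suc c) (x ∷ xs)       = x ∷ popAt c xs

  entry : ℕ → List (List ℕ) → List ℕ
  entry c       []       = []
  entry zero    (x ∷ xs) = x
  entry (suc c) (x ∷ xs) = entry c xs

  startsWith : ℕ → List ℕ → Bool
  startsWith m []      = false
  startsWith m (y ∷ x) = y ≡ᵇ m

  headAtIs : ℕ → ℕ → List (List ℕ) → Bool
  headAtIs c m ps = startsWith m (entry c ps)

  applyUpTo-pushAt : ∀ (g : ℕ → List ℕ) m k {c} → c < k →
    applyUpTo (λ b → if c ≡ᵇ b then m ∷ g b else g b) k ≡ pushAt c m (applyUpTo g k)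
  applyUpTo-pushAt g m (suc k) {zero}  _       = refl
  applyUpTo-pushAt g m (suc k) {suc c} (s≤s p) = cong (g 0 ∷_) (applyUpTo-pushAt (g ∘ suc) m k p)

  pushAt≡⇒ : ∀ c m ys {ps} → c < length ys → pushAt c m ys ≡ ps → T (headAtIs c m ps) × ys ≡ popAt c ps
  pushAt≡⇒ zero    m (y ∷ ys) _       refl = ≡⇒≡ᵇ m m refl , refl
  pushAt≡⇒ (suc c) m (y ∷ ys) (s≤s p) refl with h , e ← pushAt≡⇒ c m ys p refl = h , cong (y ∷_) e

  ⇒pushAt≡ : ∀ c m ys ps → T (headAtIs c m ps) → ys ≡ popAt c ps → pushAt c m ys ≡ ps
  ⇒pushAt≡ zero    m ys ((y ∷ x) ∷ xs) h refl rewrite ≡ᵇ⇒≡ y m h = refl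
  ⇒pushAt≡ (suc c) m ys (x ∷ xs)       h refl = cong (x ∷_) (⇒pushAt≡ c m (popAt c xs) xs h refl)

  pushAt-== : ∀ c m ys ps → c < length ys → (pushAt c m ys == ps) ≡ headAtIs c m ps ∧ (ys == popAt c ps)
  pushAt-== c m ys ps c<len = T-⇔⇒≡
    (λ t → let h , e = pushAt≡⇒ c m ys c<len (==-sound t) in T-∧-intro h (==-complete e))
    (λ t → ==-complete (⇒pushAt≡ c m ys ps (T-∧-left t) (==-sound (T-∧-right {headAtIs c m ps} t))))

  fibre-∷ : ∀ k m mu ps → fibre k (m ∷ mu) ps ≡ ∑[ c < k ] (𝟙 (headAtIs c m ps) * fibre k mu (popAt c ps))
  fibre-∷ k m mu ps =
    trans (countᵇ-allFuns-suc (λ f → puzzleOf k (m ∷ mu) f == ps) (length mu) k)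
      (∑<-cong k (λ c c<k → trans (countᵇ-cong (allFuns (length mu) k) (λ f _ → step c c<k f))
                                  (countᵇ-∧ (headAtIs c m ps) _ (allFuns (length mu) k))))
    where
    step : ∀ c → c < k → ∀ f →
      (puzzleOf k (m ∷ mu) (c ∷ f) == ps) ≡ headAtIs c m ps ∧ (puzzleOf k mu f == popAt c ps)
    step c c<k f = trans (cong (_== ps) (applyUpTo-pushAt (partsIn mu f) m k c<k))
      (pushAt-== c m (puzzleOf k mu f) ps (subst (c <_) (sym (length-applyUpTo (partsIn mu f) k)) c<k))

  ∈⇒occ-pos : ∀ {y L} → y ∈ L → 0 < occ L y
  ∈⇒occ-pos {y} (here refl) rewrite ≡ᵇ-refl y = s≤s z≤n
  ∈⇒occ-pos {y} {x ∷ L} (there p) = ≤-trans (∈⇒occ-pos p) (m≤n+m (occ L y) (𝟙 (x ≡ᵇ y)))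

  occ-pos⇒≤ : ∀ mu {m y} → All (_≤ m) mu → 0 < occ mu y → y ≤ m
  occ-pos⇒≤ (x ∷ mu) {y = y} (x≤m ∷ mu≤m) p with x ≟ y
  ... | yes refl = x≤m
  ... | no x≢y rewrite ≢⇒≡ᵇ-false x≢y = occ-pos⇒≤ mu mu≤m p

  All-≤-transport : ∀ L mu {m} → (∀ v → occ L v ≡ occ mu v) → All (_≤ m) mu → All (_≤ m) L
  All-≤-transport L mu e mu≤m = tabulate (λ {y} y∈ → occ-pos⇒≤ mu mu≤m (subst (0 <_) (e y) (∈⇒occ-pos y∈)))

  ∑-occ-entries : ∀ ps v → ∑[ c < length ps ] occ (entry c ps) v ≡ occ (concat ps) v
  ∑-occ-entries []       v = refl
  ∑-occ-entries (x ∷ ps) v = trans (cong (occ x v +_) (∑-occ-entries ps v)) (sym (occ-++ x (concat ps) v))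

  occ-concat-popAt : ∀ c m ps v → T (headAtIs c m ps) → occ (concat ps) v ≡ 𝟙 (m ≡ᵇ v) + occ (concat (popAt c ps)) v
  occ-concat-popAt zero    m ((y ∷ x) ∷ xs) v h rewrite ≡ᵇ⇒≡ y m h = refl
  occ-concat-popAt (suc c) m (x ∷ xs)       v h = begin
    occ (x ++ concat xs) v                                  ≡⟨ occ-++ x (concat xs) v ⟩
    occ x v + occ (concat xs) v                             ≡⟨ cong (occ x v +_) (occ-concat-popAt c m xs v h) ⟩
    occ x v + (𝟙 (m ≡ᵇ v) + occ (concat (popAt c xs)) v)   ≡⟨ +-left-comm (occ x v) (𝟙 (m ≡ᵇ v)) _ ⟩
    𝟙 (m ≡ᵇ v) + (occ x v + occ (concat (popAt c xs)) v)   ≡⟨ cong (𝟙 (m ≡ᵇ v) +_) (sym (occ-++ x (concat (popAt c xs)) v)) ⟩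
    𝟙 (m ≡ᵇ v) + occ (x ++ concat (popAt c xs)) v           ∎
    where open ≡-Reasoning

  length-popAt : ∀ c ps → length (popAt c ps) ≡ length ps
  length-popAt c       []             = refl
  length-popAt zero    ([] ∷ xs)      = refl
  length-popAt zero    ((y ∷ x) ∷ xs) = refl
  length-popAt (suc c) (x ∷ xs)       = cong suc (length-popAt c xs)

  Sorted-popAt : ∀ c ps → All Sorted ps → All Sorted (popAt c ps)
  Sorted-popAt c       []             a       = a
  Sorted-popAt zero    ([] ∷ xs)      a       = a
  Sorted-popAt zero    ((y ∷ x) ∷ xs) (s ∷ a) = Sorted-tail s ∷ a
  Sorted-popAt (suc c) (x ∷ xs)       (s ∷ a) = s ∷ Sorted-popAt c xs a

  All-entry : ∀ {P : List ℕ → Set} c ps → All P ps → P [] → P (entry c ps)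
  All-entry c       []       a       p[] = p[]
  All-entry zero    (x ∷ xs) (p ∷ a) p[] = p
  All-entry (suc c) (x ∷ xs) (p ∷ a) p[] = All-entry c xs a p[]

  multFactTuple-popAt : ∀ c m ps → 0 < m → T (headAtIs c m ps) → All (All (_≤ m)) ps →
    multFactTuple ps ≡ multFactTuple (popAt c ps) * occ (entry c ps) m
  multFactTuple-popAt zero m ((y ∷ x) ∷ xs) 0<m h ((_ ∷ x≤m) ∷ _) rewrite ≡ᵇ⇒≡ y m h =
    trans (cong (_* multFactTuple xs) (multFact-∷-max m x 0<m x≤m))
          (rearrange (multFact x) (occ (m ∷ x) m) (multFactTuple xs))
    where
    rearrange : ∀ p q r → p * q * r ≡ p * r * q
    rearrange = solve-∀
  multFactTuple-popAt (suc c) m (x ∷ xs) 0<m h (_ ∷ a) =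
    trans (cong (multFact x *_) (multFactTuple-popAt c m xs 0<m h a)) (sym (*-assoc (multFact x) _ _))

  occ-≡0-unless-startsWith : ∀ m x → Sorted x → All (_≤ m) x → ¬ T (startsWith m x) → occ x m ≡ 0
  occ-≡0-unless-startsWith m []      s a         h = refl
  occ-≡0-unless-startsWith m (y ∷ x) s (y≤m ∷ _) h =
    trans (cong (λ z → 𝟙 z + occ x m) (¬T⇒≡false h))
          (occ-above x (Sorted-head-max s) (≤∧≢⇒< y≤m (h ∘ ≡⇒≡ᵇ y m)))

  emptyPuzzle : ℕ → List (List ℕ)
  emptyPuzzle k = applyUpTo (λ _ → []) k

  ≡emptyPuzzle : ∀ ps k → length ps ≡ k → (∀ v → occ (concat ps) v ≡ 0) → ps ≡ emptyPuzzle k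
  ≡emptyPuzzle []             zero    e z = refl
  ≡emptyPuzzle ([] ∷ ps)      (suc k) e z = cong ([] ∷_) (≡emptyPuzzle ps k (suc-injective e) z)
  ≡emptyPuzzle ((y ∷ x) ∷ ps) (suc k) e z =
    ⊥-elim (<⇒≢ (∈⇒occ-pos {y} {concat ((y ∷ x) ∷ ps)} (here refl)) (sym (z y)))

  multFactTuple-emptyPuzzle : ∀ k → multFactTuple (emptyPuzzle k) ≡ 1
  multFactTuple-emptyPuzzle zero    = refl
  multFactTuple-emptyPuzzle (suc k) = trans (+-identityʳ _) (multFactTuple-emptyPuzzle k)

  -- Induction on μ: in every assignment of the fibre its largest part heads one of the blocks.
  fibre-*-multFactTuple : ∀ k mu ps → Sorted mu → All (0 <_) mu → length ps ≡ k → All Sorted ps →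
    (∀ v → occ (concat ps) v ≡ occ mu v) → fibre k mu ps * multFactTuple ps ≡ multFact mu
  fibre-*-multFactTuple k [] ps _ _ len≡k _ content rewrite ≡emptyPuzzle ps k len≡k content
                                                          | multFactTuple-emptyPuzzle k
                                                          | T⇒≡true (==-complete {emptyPuzzle k} refl) = refl
  fibre-*-multFactTuple k (m ∷ mu) ps s (0<m ∷ 0<mu) len≡k sorted content = begin
    fibre k (m ∷ mu) ps * multFactTuple ps
      ≡⟨ cong (_* multFactTuple ps) (fibre-∷ k m mu ps) ⟩
    ∑[ c < k ] (𝟙 (headAtIs c m ps) * fibre k mu (popAt c ps)) * multFactTuple ps
      ≡⟨ sym (∑<-*ʳ k _ (multFactTuple ps)) ⟩
    ∑[ c < k ] (𝟙 (headAtIs c m ps) * fibre k mu (popAt c ps) * multFactTuple ps)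
      ≡⟨ ∑<-cong k perBlock ⟩
    ∑[ c < k ] (multFact mu * occ (entry c ps) m)
      ≡⟨ ∑<-*ˡ k (multFact mu) _ ⟩
    multFact mu * ∑[ c < k ] occ (entry c ps) m
      ≡⟨ cong (multFact mu *_)
              (trans (cong (λ n → ∑[ c < n ] occ (entry c ps) m) (sym len≡k)) (∑-occ-entries ps m)) ⟩
    multFact mu * occ (concat ps) m
      ≡⟨ cong (multFact mu *_) (content m) ⟩
    multFact mu * occ (m ∷ mu) m
      ≡⟨ sym (multFact-∷-max m mu 0<m (Sorted-head-max s)) ⟩
    multFact (m ∷ mu) ∎
    where
    open ≡-Reasoning
    ps≤m : All (All (_≤ m)) ps
    ps≤m = concat⁻ (All-≤-transport (concat ps) (m ∷ mu) content (≤-refl ∷ Sorted-head-max s))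
    perBlock : ∀ c → c < k →
      𝟙 (headAtIs c m ps) * fibre k mu (popAt c ps) * multFactTuple ps ≡ multFact mu * occ (entry c ps) m
    perBlock c c<k with headAtIs c m ps in eq
    ... | true = begin
      (fibre k mu (popAt c ps) + 0) * multFactTuple ps
        ≡⟨ cong₂ _*_ (+-identityʳ (fibre k mu (popAt c ps))) (multFactTuple-popAt c m ps 0<m h ps≤m) ⟩
      fibre k mu (popAt c ps) * (multFactTuple (popAt c ps) * occ (entry c ps) m)
        ≡⟨ sym (*-assoc (fibre k mu (popAt c ps)) _ _) ⟩
      fibre k mu (popAt c ps) * multFactTuple (popAt c ps) * occ (entry c ps) m
        ≡⟨ cong (_* occ (entry c ps) m)
             (fibre-*-multFactTuple k mu (popAt c ps) (Sorted-tail s) 0<mu (trans (length-popAt c ps) len≡k)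
               (Sorted-popAt c ps sorted)
               (λ v → +-cancelˡ-≡ (𝟙 (m ≡ᵇ v)) _ _ (trans (sym (occ-concat-popAt c m ps v h)) (content v)))) ⟩
      multFact mu * occ (entry c ps) m ∎
      where
      h : T (headAtIs c m ps)
      h = subst T (sym eq) tt
    ... | false = sym (trans (cong (multFact mu *_)
                               (occ-≡0-unless-startsWith m (entry c ps) (All-entry c ps sorted [])
                                 (All-entry c ps ps≤m []) (subst T eq)))
                             (*-zeroʳ (multFact mu)))

  sum-partsIn : ∀ mu f b → length f ≡ length mu → sum (partsIn mu f b) ≡ load mu f b
  sum-partsIn []       []      b e = refl
  sum-partsIn (m ∷ mu) (c ∷ f) b e with c ≡ᵇ b
  ... | true  = cong (m +_) (sum-partsIn mu f b (suc-injective e))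
  ... | false = sum-partsIn mu f b (suc-injective e)

  All-partsIn : ∀ {P : ℕ → Set} mu f b → All P mu → All P (partsIn mu f b)
  All-partsIn []       f       b a        = []
  All-partsIn (m ∷ mu) []      b a        = []
  All-partsIn (m ∷ mu) (c ∷ f) b (pm ∷ a) with c ≡ᵇ b
  ... | true  = pm ∷ All-partsIn mu f b a
  ... | false = All-partsIn mu f b a

  Sorted-partsIn : ∀ mu f b → Sorted mu → Sorted (partsIn mu f b)
  Sorted-partsIn []       f       b s = []
  Sorted-partsIn (m ∷ mu) []      b s = []
  Sorted-partsIn (m ∷ mu) (c ∷ f) b s with c ≡ᵇ b
  ... | true  = Sorted-∷ (All-partsIn mu f b (Sorted-head-max s)) (Sorted-partsIn mu f b (Sorted-tail s))
  ... | false = Sorted-partsIn mu f b (Sorted-tail s)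

  Pointwise-applyUpTo⁺ : ∀ {R : List ℕ → ℕ → Set} (g : ℕ → List ℕ) lam →
    (∀ b → b < length lam → R (g b) (at lam b)) → Pointwise R (applyUpTo g (length lam)) lam
  Pointwise-applyUpTo⁺ g []        h = []
  Pointwise-applyUpTo⁺ g (l ∷ lam) h =
    h 0 (s≤s z≤n) ∷ Pointwise-applyUpTo⁺ (g ∘ suc) lam (λ b p → h (suc b) (s≤s p))

  Pointwise-applyUpTo⁻ : ∀ {R : List ℕ → ℕ → Set} (g : ℕ → List ℕ) lam →
    Pointwise R (applyUpTo g (length lam)) lam → ∀ b → b < length lam → R (g b) (at lam b)
  Pointwise-applyUpTo⁻ g (l ∷ lam) (r ∷ _)  zero    _       = r
  Pointwise-applyUpTo⁻ g (l ∷ lam) (_ ∷ rs) (suc b) (s≤s p) = Pointwise-applyUpTo⁻ (g ∘ suc) lam rs b p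

  concat-pushAt : ∀ c m ys → c < length ys → concat (pushAt c m ys) ↭ m ∷ concat ys
  concat-pushAt zero    m (y ∷ ys) _       = ↭-refl
  concat-pushAt (suc c) m (y ∷ ys) (s≤s p) = ↭-trans (++⁺ˡ y (concat-pushAt c m ys p)) (shift m y (concat ys))

  concat-emptyPuzzle : ∀ k → concat (emptyPuzzle k) ≡ []
  concat-emptyPuzzle zero    = refl
  concat-emptyPuzzle (suc k) = concat-emptyPuzzle k

  concat-puzzleOf : ∀ k mu f → length f ≡ length mu → All (_< k) f → concat (puzzleOf k mu f) ↭ mu
  concat-puzzleOf k []       []      e a rewrite concat-emptyPuzzle k = ↭-refl
  concat-puzzleOf k (m ∷ mu) (c ∷ f) e (c<k ∷ a) rewrite applyUpTo-pushAt (partsIn mu f) m k c<k =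
    ↭-trans (concat-pushAt c m (puzzleOf k mu f) (subst (c <_) (sym (length-applyUpTo (partsIn mu f) k)) c<k))
            (↭-prep m (concat-puzzleOf k mu f (suc-injective e) a))

  puzzleOf-isPuzzle : ∀ mu lam f → IsPartition mu → length f ≡ length mu → All (_< length lam) f →
    T (weightOK mu lam f) → IsPuzzle mu lam (puzzleOf (length lam) mu f)
  puzzleOf-isPuzzle mu lam f (sorted , positive) len≡ f<k t =
    Pointwise-applyUpTo⁺ (partsIn mu f) lam (λ b b<k →
      (Sorted-partsIn mu f b sorted , All-partsIn mu f b positive) ,
      trans (sum-partsIn mu f b len≡)
            (≡ᵇ⇒≡ _ _ (allBelow-elim (length lam) _ (subst T (weightOK≡fills mu lam f) t) b b<k)))
    , concat-puzzleOf (length lam) mu f len≡ f<k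

  puzzleOf-≡⇒weightOK : ∀ mu lam f ps → IsPuzzle mu lam ps → length f ≡ length mu →
    puzzleOf (length lam) mu f ≡ ps → T (weightOK mu lam f)
  puzzleOf-≡⇒weightOK mu lam f ps (blocks , _) len≡ refl =
    subst T (sym (weightOK≡fills mu lam f)) (allBelow-intro (length lam) _ (λ b b<k →
      ≡⇒≡ᵇ _ _ (trans (sym (sum-partsIn mu f b len≡))
                      (proj₂ (Pointwise-applyUpTo⁻ (partsIn mu f) lam blocks b b<k)))))

  ↭-occ : ∀ {xs ys} → xs ↭ ys → ∀ v → occ xs v ≡ occ ys v
  ↭-occ ↭.refl              v = refl
  ↭-occ (↭.prep x p)        v = cong (𝟙 (x ≡ᵇ v) +_) (↭-occ p v)
  ↭-occ {ys = _ ∷ _ ∷ ys} (↭.swap x y p) v = trans (cong (λ z → 𝟙 (x ≡ᵇ v) + (𝟙 (y ≡ᵇ v) + z)) (↭-occ p v))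
                                                    (+-left-comm (𝟙 (x ≡ᵇ v)) (𝟙 (y ≡ᵇ v)) (occ ys v))
  ↭-occ (↭.trans p q)       v = trans (↭-occ p v) (↭-occ q v)

  fibre-puzzle : ∀ mu lam ps → IsPartition mu → IsPuzzle mu lam ps →
    fibre (length lam) mu ps * multFactTuple ps ≡ multFact mu
  fibre-puzzle mu lam ps (sorted , positive) (blocks , perm) =
    fibre-*-multFactTuple (length lam) mu ps sorted positive (Pointwise-length blocks) (blocksSorted blocks) (↭-occ perm)
    where
    blocksSorted : ∀ {ps lam} → Pointwise (λ ν l → IsPartition ν × sum ν ≡ l) ps lam → All Sorted ps
    blocksSorted []                  = []
    blocksSorted (((s , _) , _) ∷ r) = s ∷ blocksSorted r

  ≢⇒==-false : ∀ {xs ys} → xs ≢ ys → (xs == ys) ≡ false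
  ≢⇒==-false xs≢ys = ¬T⇒≡false (xs≢ys ∘ ==-sound)

  ∑-==-unique : ∀ (P : List (List (List ℕ))) {y} → Unique P → y ∈ P → ∑[ s ← P ] 𝟙 (y == s) ≡ 1
  ∑-==-unique (s ∷ P) (s∉P ∷ _) (here refl) =
    cong₂ _+_ (cong 𝟙 (T⇒≡true (==-complete {s} refl)))
              (trans (∑∈-cong P (λ s′ s′∈ → cong 𝟙 (≢⇒==-false (All-lookup s∉P s′∈)))) (∑∈-zero P))
  ∑-==-unique (s ∷ P) (s∉P ∷ u) (there y∈) =
    cong₂ _+_ (cong 𝟙 (≢⇒==-false (All-lookup s∉P y∈ ∘ sym))) (∑-==-unique P u y∈)

  count-by-fibres : ∀ {X : Set} (Fs : List X) (ok : X → Bool) (π : X → List (List ℕ)) (P : List (List (List ℕ))) →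
    Unique P → (∀ {f} → f ∈ Fs → T (ok f) → π f ∈ P) →
    countᵇ ok Fs ≡ ∑[ s ← P ] countᵇ (λ f → ok f ∧ (π f == s)) Fs
  count-by-fibres Fs ok π P u lands = begin
    countᵇ ok Fs                                 ≡⟨ countᵇ-≡-∑ ok Fs ⟩
    ∑[ f ← Fs ] 𝟙 (ok f)                         ≡⟨ ∑∈-cong Fs split ⟩
    ∑[ f ← Fs ] ∑[ s ← P ] 𝟙 (ok f ∧ (π f == s)) ≡⟨ ∑∈-comm Fs P (λ f s → 𝟙 (ok f ∧ (π f == s))) ⟩
    ∑[ s ← P ] ∑[ f ← Fs ] 𝟙 (ok f ∧ (π f == s)) ≡⟨ ∑∈-cong P (λ s _ → sym (countᵇ-≡-∑ _ Fs)) ⟩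
    ∑[ s ← P ] countᵇ (λ f → ok f ∧ (π f == s)) Fs ∎
    where
    open ≡-Reasoning
    split : ∀ f → f ∈ Fs → 𝟙 (ok f) ≡ ∑[ s ← P ] 𝟙 (ok f ∧ (π f == s))
    split f f∈ with ok f in eq
    ... | true  = sym (∑-==-unique P u (lands f∈ (subst T (sym eq) tt)))
    ... | false = sym (∑∈-zero P)

  coeffMp≡∑-fibres : ∀ mu lam (P : List (List (List ℕ))) → IsPartition mu → Unique P →
    (∀ ps → (ps ∈ P) ⇔ IsPuzzle mu lam ps) → coeffMp mu lam ≡ ∑[ ps ← P ] fibre (length lam) mu ps
  coeffMp≡∑-fibres mu lam P mu-partition u P≡puzzles =
    trans (count-by-fibres Fs (weightOK mu lam) (puzzleOf k mu) P u lands)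
          (∑∈-cong P (λ ps ps∈ → countᵇ-cong Fs (λ f f∈ →
            weightOK-redundant ps (Equivalence.to (P≡puzzles ps) ps∈) f (proj₁ (allFuns-shape f∈)))))
    where
    k  = length lam
    Fs = allFuns (length mu) k
    lands : ∀ {f} → f ∈ Fs → T (weightOK mu lam f) → puzzleOf k mu f ∈ P
    lands f∈ t = let len≡ , f<k = allFuns-shape f∈ in
      Equivalence.from (P≡puzzles _) (puzzleOf-isPuzzle mu lam _ mu-partition len≡ f<k t)
    weightOK-redundant : ∀ ps → IsPuzzle mu lam ps → ∀ f → length f ≡ length mu →
      (weightOK mu lam f ∧ (puzzleOf k mu f == ps)) ≡ (puzzleOf k mu f == ps)
    weightOK-redundant ps puzzle f len≡ with puzzleOf k mu f == ps in eq
    ... | false = ∧-zeroʳ (weightOK mu lam f)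
    ... | true  rewrite T⇒≡true (puzzleOf-≡⇒weightOK mu lam f ps puzzle len≡ (==-sound (subst T (sym eq) tt))) =
      refl

module Fractions where

  open import Data.Nat using (ℕ; zero; suc; NonZero; _+_; _*_)
  open import Data.Nat.Properties using (m*n≢0; *-identityˡ; *-comm; *-assoc)
  open import Data.Nat.Tactic.RingSolver using (solve-∀)
  open import Data.Integer using (+_)
  import Data.Integer as ℤ
  open import Data.Integer.Properties using (pos-*; pos-+)
  open import Data.Rational as ℚ using (_/_; toℚᵘ)
  open import Data.Rational.Properties using (toℚᵘ-injective; toℚᵘ-fromℚᵘ; toℚᵘ-homo-*; toℚᵘ-homo-+)
  import Data.Rational.Unnormalised as ℚᵘ
  import Data.Rational.Unnormalised.Properties as ℚᵘ
  open import Data.List using (List; []; _∷_; map; length)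
  open import Data.List.Properties using (map-cong-local)
  open import Data.List.Relation.Unary.All using (tabulate)
  open import Data.List.Membership.Propositional using (_∈_)
  open import Data.List.Relation.Unary.Unique.Propositional using (Unique)
  open import Data.Empty using (⊥-elim)
  open import Function using (_⇔_; Equivalence)
  open import Relation.Binary.PropositionalEquality
  open import Defs
  open Counting using (∑∈; fibre; fibre-puzzle; coeffMp≡∑-fibres)

  -- A zero denominator is excluded by the instance, but has to be refuted by hand
  -- to reach the representation mkℚᵘ (+ a) b of (+ a) / suc b.
  toℚᵘ-/ : ∀ a b {{_ : NonZero b}} → toℚᵘ ((+ a) / b) ℚᵘ.≃ ((+ a) ℚᵘ./ b)
  toℚᵘ-/ a zero {{nz}} = ⊥-elim (NonZero.nonZero nz)
  toℚᵘ-/ a (suc b)     = toℚᵘ-fromℚᵘ (ℚᵘ.mkℚᵘ (+ a) b)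

  /-cross : ∀ a b c d {{_ : NonZero b}} {{_ : NonZero d}} → a * d ≡ c * b → (+ a) / b ≡ (+ c) / d
  /-cross a zero    c d       {{nz}}       _ = ⊥-elim (NonZero.nonZero nz)
  /-cross a (suc b) c zero    {{_}} {{nz}} _ = ⊥-elim (NonZero.nonZero nz)
  /-cross a (suc b) c (suc d) ad≡cb = toℚᵘ-injective
    (ℚᵘ.≃-trans (toℚᵘ-/ a (suc b)) (ℚᵘ.≃-trans (ℚᵘ.*≡* cross) (ℚᵘ.≃-sym (toℚᵘ-/ c (suc d)))))
    where
    cross : (+ a) ℤ.* (+ suc d) ≡ (+ c) ℤ.* (+ suc b)
    cross = trans (sym (pos-* a (suc d))) (trans (cong +_ ad≡cb) (pos-* c (suc b)))

  /-*-/ : ∀ a b c d {{_ : NonZero b}} {{_ : NonZero d}} →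
    ((+ a) / b) ℚ.* ((+ c) / d) ≡ ((+ (a * c)) / (b * d)) {{m*n≢0 b d}}
  /-*-/ a zero    c d       {{nz}}       = ⊥-elim (NonZero.nonZero nz)
  /-*-/ a (suc b) c zero    {{_}} {{nz}} = ⊥-elim (NonZero.nonZero nz)
  /-*-/ a (suc b) c (suc d) = toℚᵘ-injective
    (ℚᵘ.≃-trans (toℚᵘ-homo-* ((+ a) / suc b) ((+ c) / suc d))
      (ℚᵘ.≃-trans (ℚᵘ.*-cong (toℚᵘ-/ a (suc b)) (toℚᵘ-/ c (suc d)))
        (ℚᵘ.≃-trans (ℚᵘ.≃-reflexive (cong (λ z → ℚᵘ.mkℚᵘ z (d + b * suc d)) (sym (pos-* a c))))
          (ℚᵘ.≃-sym (toℚᵘ-/ (a * c) (suc b * suc d))))))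

  /-+-/ : ∀ a c d {{_ : NonZero d}} → ((+ a) / d) ℚ.+ ((+ c) / d) ≡ (+ (a + c)) / d
  /-+-/ a c zero    {{nz}} = ⊥-elim (NonZero.nonZero nz)
  /-+-/ a c (suc d) = trans
    (toℚᵘ-injective (ℚᵘ.≃-trans (toℚᵘ-homo-+ ((+ a) / suc d) ((+ c) / suc d))
      (ℚᵘ.≃-trans (ℚᵘ.+-cong (toℚᵘ-/ a (suc d)) (toℚᵘ-/ c (suc d)))
        (ℚᵘ.≃-trans (ℚᵘ.≃-reflexive (cong (λ z → ℚᵘ.mkℚᵘ z (d + d * suc d)) (sym numerator)))
          (ℚᵘ.≃-sym (toℚᵘ-/ (a * suc d + c * suc d) (suc d * suc d)))))))
    (/-cross (a * suc d + c * suc d) (suc d * suc d) (a + c) (suc d) (distrib a c (suc d)))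
    where
    numerator : + (a * suc d + c * suc d) ≡ (+ a) ℤ.* (+ suc d) ℤ.+ (+ c) ℤ.* (+ suc d)
    numerator = trans (pos-+ (a * suc d) (c * suc d)) (cong₂ ℤ._+_ (pos-* a (suc d)) (pos-* c (suc d)))
    distrib : ∀ a c e → (a * e + c * e) * e ≡ (a + c) * (e * e)
    distrib = solve-∀

  sumℚ-map-/ : ∀ {X : Set} D {{_ : NonZero D}} (h : X → ℕ) xs →
    sumℚ (map (λ x → (+ h x) / D) xs) ≡ (+ ∑∈ xs h) / D
  sumℚ-map-/ D h []       = /-cross 0 1 0 D refl
  sumℚ-map-/ D h (x ∷ xs) = trans (cong ((+ h x) / D ℚ.+_) (sumℚ-map-/ D h xs)) (/-+-/ (h x) (∑∈ xs h) D)

  sumℚ-puzzleWeight : ∀ mu lam (P : List (List (List ℕ))) → IsPartition mu → Unique P →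
    (∀ ps → (ps ∈ P) ⇔ IsPuzzle mu lam ps) →
    sumℚ (map puzzleWeight P) ≡ ((+ coeffMp mu lam) / multFact mu) {{multFact-nz mu}}
  sumℚ-puzzleWeight mu lam P mu-partition unique P≡puzzles = begin
    sumℚ (map puzzleWeight P)
      ≡⟨ cong sumℚ (map-cong-local (tabulate (weight≡ _))) ⟩
    sumℚ (map (λ ps → (+ fibre k mu ps) / D) P)
      ≡⟨ sumℚ-map-/ D (fibre k mu) P ⟩
    (+ ∑∈ P (fibre k mu)) / D
      ≡⟨ cong (λ n → (+ n) / D) (sym (coeffMp≡∑-fibres mu lam P mu-partition unique P≡puzzles)) ⟩
    (+ coeffMp mu lam) / D ∎
    where
    open ≡-Reasoning
    k = length lam
    D = multFact mu
    instance
      D≢0 : NonZero D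
      D≢0 = multFact-nz mu
    weight≡ : ∀ ps → ps ∈ P → puzzleWeight ps ≡ (+ fibre k mu ps) / D
    weight≡ ps ps∈ = /-cross 1 (multFactTuple ps) (fibre k mu ps) D {{multFactTuple-nz ps}}
      (trans (*-identityˡ D) (sym (fibre-puzzle mu lam ps mu-partition (Equivalence.to (P≡puzzles ps) ps∈))))

  factRatio-*-/ : ∀ lam mu a b {{_ : NonZero b}} r → r * prodFact mu ≡ a * prodFact lam →
    factRatio lam mu ℚ.* ((+ a) / b) ≡ (+ r) / b
  factRatio-*-/ lam mu a b r rM≡aL =
    trans (/-*-/ (prodFact lam) (prodFact mu) a b {{prodFact-nz mu}})
          (/-cross (prodFact lam * a) (prodFact mu * b) r b {{m*n≢0 _ _ {{prodFact-nz mu}}}}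
             (trans (cong (_* b) (trans (*-comm (prodFact lam) a) (sym rM≡aL))) (*-assoc r (prodFact mu) b)))

open import Defs
open import Data.Nat using (ℕ)
open import Data.List using (List; map)
open import Data.Nat.ListAction using (sum)
open import Data.List.Relation.Unary.Unique.Propositional using (Unique)
open import Data.List.Membership.Propositional using (_∈_)
open import Data.Product using (_×_; _,_; proj₂)
open import Data.Rational using (ℚ; _*_)
open import Function.Bundles using (_⇔_)
open import Relation.Binary.PropositionalEquality using (_≡_; sym; trans; cong)
open Counting using (coeffMr-*-prodFact)
open Fractions using (sumℚ-puzzleWeight; factRatio-*-/)

mainTheorem4 : (lam mu : List ℕ) → IsPartition lam → IsPartition mu → sum lam ≡ sum mu →
    ((P : List (List (List ℕ))) → Unique P → (∀ ps → (ps ∈ P) ⇔ IsPuzzle mu lam ps) →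
      coeffMtildeR lam mu ≡ factRatio lam mu * sumℚ (map puzzleWeight P))
    × (ℕtoℚ (coeffMr lam mu) ≡ factRatio lam mu * ℕtoℚ (coeffMp mu lam))
mainTheorem4 lam mu _ mu-partition _ = puzzleExpansion , powerSumComparison
  where
  powerSumComparison : ℕtoℚ (coeffMr lam mu) ≡ factRatio lam mu * ℕtoℚ (coeffMp mu lam)
  powerSumComparison =
    sym (factRatio-*-/ lam mu (coeffMp mu lam) 1 (coeffMr lam mu) (coeffMr-*-prodFact lam mu (proj₂ mu-partition)))
  puzzleExpansion : (P : List (List (List ℕ))) → Unique P → (∀ ps → (ps ∈ P) ⇔ IsPuzzle mu lam ps) →
    coeffMtildeR lam mu ≡ factRatio lam mu * sumℚ (map puzzleWeight P)
  puzzleExpansion P unique P≡puzzles = sym (trans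
    (cong (factRatio lam mu *_) (sumℚ-puzzleWeight mu lam P mu-partition unique P≡puzzles))
    (factRatio-*-/ lam mu (coeffMp mu lam) (multFact mu) {{multFact-nz mu}} (coeffMr lam mu)
                   (coeffMr-*-prodFact lam mu (proj₂ mu-partition))))
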